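{- Let $\mathbf{d}=(d_1,\dots,d_n)$ be a multigraphical sequence. Then $\mathbf{d}$ admits a loopless multigraph realization containing two spanning trees that share at most one edge if and only if $\sum_{i=1}^n d_i\ge 4(n-1)-2$ and either (a) $n\le 2$, or (b) $n>2$, $d_{n-1}\ge 2$ and $d_n\ge 1$.
   Context: A degree sequence is non-increasing, $d_1\ge\dots\ge d_n\ge 0$; it is multigraphical if some loopless multigraph (parallel edges allowed) on $v_1,\dots,v_n$ has $\deg(v_i)=d_i$ (a realization). A spanning tree of a multigraph is a set of edges (specific parallel copies) forming a tree containing all vertices; two spanning trees share at most one edge if at most one edge (copy) belongs to both. -}

module Defs where

open import Data.Nat using (ℕ; zero; suc; _+_; _≤_)
open import Data.Fin using (Fin; _≟_) renaming (_≤_ to _≤ᶠ_)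
open import Data.Fin.Subset using (Subset; _∈_; _∉_; ∣_∣; _∩_; _-_)
open import Data.List using (List; map; allFin)
open import Data.Nat.ListAction using (sum)
open import Data.Product using (_×_; _,_; proj₁; proj₂; Σ; ∃)
open import Relation.Binary.PropositionalEquality using (_≡_; _≢_)
open import Relation.Nullary using (¬_; does)
open import Data.Bool using (if_then_else_)

-- A loopless multigraph on vertex set Fin n: m edges (each edge copy is an
-- index e : Fin m), each with two distinct endpoints. Parallel edges = distinct
-- indices with the same endpoints.
record Multigraph (n : ℕ) : Set where
  field
    m        : ℕ
    ends     : Fin m → Fin n × Fin n
    loopless : ∀ e → proj₁ (ends e) ≢ proj₂ (ends e)
open Multigraph public

[_≟_] : ∀ {n} → Fin n → Fin n → ℕ
[ v ≟ w ] = if does (v ≟ w) then 1 else 0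

degree : ∀ {n} → Multigraph n → Fin n → ℕ
degree G v = sum (map (λ e → [ v ≟ proj₁ (ends G e) ] + [ v ≟ proj₂ (ends G e) ]) (allFin (m G)))

Realizes : ∀ {n} → Multigraph n → (Fin n → ℕ) → Set
Realizes G d = ∀ v → degree G v ≡ d v

NonIncreasing : ∀ {n} → (Fin n → ℕ) → Set
NonIncreasing {n} d = ∀ (i j : Fin n) → i ≤ᶠ j → d j ≤ d i

Multigraphical : ∀ {n} → (Fin n → ℕ) → Set
Multigraphical {n} d = Σ (Multigraph n) λ G → Realizes G d

data Reach {n} (G : Multigraph n) (S : Subset (m G)) (u : Fin n) : Fin n → Set where
  here : Reach G S u u
  fwd  : ∀ {e} → e ∈ S → Reach G S u (proj₁ (ends G e)) → Reach G S u (proj₂ (ends G e))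
  bwd  : ∀ {e} → e ∈ S → Reach G S u (proj₂ (ends G e)) → Reach G S u (proj₁ (ends G e))

Connected : ∀ {n} (G : Multigraph n) → Subset (m G) → Set
Connected {n} G S = ∀ (u v : Fin n) → Reach G S u v

-- acyclic: no edge of S lies on a cycle, i.e. for no edge e ∈ S are its
-- endpoints still joined in S without e
Acyclic : ∀ {n} (G : Multigraph n) → Subset (m G) → Set
Acyclic G S = ∀ e → e ∈ S → ¬ Reach G (S - e) (proj₁ (ends G e)) (proj₂ (ends G e))

SpanningTree : ∀ {n} (G : Multigraph n) → Subset (m G) → Set
SpanningTree G T = Connected G T × Acyclic G T

TwoTreesShareAtMostOne : ∀ {n} → Multigraph n → Set
TwoTreesShareAtMostOne G =
  Σ (Subset (m G)) λ T₁ → Σ (Subset (m G)) λ T₂ →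
    SpanningTree G T₁ × SpanningTree G T₂ × ∣ T₁ ∩ T₂ ∣ ≤ 1

Σd : ∀ {n} → (Fin n → ℕ) → ℕ
Σd {n} d = sum (map d (allFin n))

{-# OPTIONS --safe #-}
module Submission where

-- Necessity: a connected spanning edge set has at least n − 1 edges, so two of them sharing at
-- most one edge need m ≥ 2n − 3 edges, i.e. ∑ d ≥ 4n − 6.  If the two smallest degrees were both 1,
-- each tree would contain the edge at each leaf; these two edges are distinct (otherwise the two
-- leaves would form a component of their own), so the trees would share two edges.
--
-- Sufficiency, by induction on m: a sequence with ∑ d = 2m and all d v ≤ m has a realization with
-- two edge-disjoint connected spanning edge sets if all degrees are ≥ 2 and m ≥ 2n − 2, and one
-- whose sets share at most one edge if all degrees are ≥ 1, at most one is 1 (when n > 2), and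
-- m ≥ 2n − 3.  In the first case, if m > 2n − 2, remove an edge between two vertices of largest
-- degree.  Otherwise split off a vertex z of degree 1, 2 or 3: realize the smaller sequence, then
-- reattach z to a suitable vertex c by one new edge (shared by both sets) or two (one for each
-- set), and, if needed, let z take over one edge of c.

open import Defs
open import Data.Bool.Base using (true; false)
open import Data.Empty using (⊥-elim)
open import Data.Fin.Base using (Fin; zero; suc; toℕ; fromℕ; fromℕ<; inject₁; punchIn; punchOut)
open import Data.Fin.Properties
  using (_≟_; any?; toℕ-fromℕ; toℕ-fromℕ<; toℕ-inject₁; toℕ<n; toℕ-injective;
         punchIn-injective; punchInᵢ≢i; punchIn-punchOut; punchOut-injective)
  renaming (suc-injective to fsuc-injective)
open import Data.Fin.Subset using (Subset; _∈_; _∉_; _⊆_; _-_; ∣_∣; _∩_; _∪_)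
open import Data.Fin.Subset.Properties
  using (_∈?_; nonempty?; x∈p∧x≢y⇒x∈p-y; x∈p⇒∣p-x∣<∣p∣; p─q⊆p; ∣p∣≤n; p⊆q⇒∣p∣≤∣q∣; x∈p∩q⁺; x∈p∩q⁻)
open import Data.List.Base using (map; allFin; tabulate)
open import Data.List.Extrema.Nat using (argmax; f[xs]≤f[argmax])
open import Data.List.Membership.Propositional.Properties using (∈-allFin)
import Data.List.Relation.Unary.All as All
open import Data.List.Properties using (map-tabulate)
open import Data.Nat.Base hiding (∣_-_∣)
open import Data.Nat.Induction using (<-rec)
import Data.Nat.ListAction as List
open import Data.Nat.Properties hiding (_≟_)
open import Data.Nat.Properties using () renaming (_≟_ to _≟ℕ_)
open import Data.Nat.Tactic.RingSolver using (solve-∀)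
open import Data.Product using (_×_; _,_; proj₁; proj₂; Σ; ∃; ∃-syntax)
open import Data.Sum using (_⊎_; inj₁; inj₂)
import Data.Sum as Sum
open import Data.Vec.Base using ([]; _∷_; here; there)
open import Data.Vec.Functional using (removeAt; updateAt)
open import Data.Vec.Functional.Properties using (updateAt-updates; updateAt-minimal)
open import Function.Base using (_∘_; id)
open import Function.Bundles using (_⇔_; mk⇔)
open import Relation.Binary.PropositionalEquality hiding ([_])
open import Relation.Nullary using (¬_; Dec; yes; no)
open import Relation.Nullary.Decidable using (_×-dec_; map′)
open import Algebra.Properties.CommutativeMonoid.Sum +-0-commutativeMonoid
  using (sum-cong-≗; sum-remove; ∑-distrib-+; ∑-comm) renaming (sum to ∑)

sum-allFin : ∀ {k} (f : Fin k → ℕ) → List.sum (map f (allFin k)) ≡ ∑ f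
sum-allFin {zero}  f = refl
sum-allFin {suc k} f = cong (f zero +_) (begin
  List.sum (map f (tabulate suc))          ≡⟨ cong List.sum (map-tabulate suc f) ⟩
  List.sum (tabulate (f ∘ suc))            ≡⟨ cong List.sum (map-tabulate id (f ∘ suc)) ⟨
  List.sum (map (f ∘ suc) (allFin k))      ≡⟨ sum-allFin (f ∘ suc) ⟩
  ∑ (f ∘ suc)                              ∎)
  where open ≡-Reasoning

∑-const : ∀ k c → ∑ {k} (λ _ → c) ≡ k * c
∑-const zero    c = refl
∑-const (suc k) c = cong (c +_) (∑-const k c)

∑-mono-≤ : ∀ {k} {f g : Fin k → ℕ} → (∀ i → f i ≤ g i) → ∑ f ≤ ∑ g
∑-mono-≤ {zero}  f≤g = z≤n
∑-mono-≤ {suc k} f≤g = +-mono-≤ (f≤g zero) (∑-mono-≤ (f≤g ∘ suc))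

∑-≥-const : ∀ {k} (f : Fin k → ℕ) {L} → (∀ i → L ≤ f i) → k * L ≤ ∑ f
∑-≥-const {k} f {L} L≤f = subst (_≤ ∑ f) (∑-const k L) (∑-mono-≤ L≤f)

∑-≤-const : ∀ {k} (f : Fin k → ℕ) {U} → (∀ i → f i ≤ U) → ∑ f ≤ k * U
∑-≤-const {k} f {U} f≤U = subst (∑ f ≤_) (∑-const k U) (∑-mono-≤ f≤U)

term≤∑ : ∀ {k} (f : Fin k → ℕ) i → f i ≤ ∑ f
term≤∑ f zero    = m≤m+n _ _
term≤∑ f (suc i) = ≤-trans (term≤∑ (f ∘ suc) i) (m≤n+m _ _)

two-terms≤∑ : ∀ {k} (f : Fin k → ℕ) {i j} → i ≢ j → f i + f j ≤ ∑ f
two-terms≤∑ {suc k} f {i} {j} i≢j = begin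
  f i + f j                          ≡⟨ cong (λ x → f i + f x) (punchIn-punchOut i≢j) ⟨
  f i + f (punchIn i (punchOut i≢j)) ≤⟨ +-monoʳ-≤ (f i) (term≤∑ (f ∘ punchIn i) (punchOut i≢j)) ⟩
  f i + ∑ (f ∘ punchIn i)            ≡⟨ sum-remove f ⟨
  ∑ f                                ∎
  where open ≤-Reasoning

three-terms≤∑ : ∀ {k} (f : Fin k → ℕ) {a b c} → a ≢ b → a ≢ c → b ≢ c → f a + f b + f c ≤ ∑ f
three-terms≤∑ {suc k} f {a} {b} {c} a≢b a≢c b≢c = begin
  f a + f b + f c                           ≡⟨ +-assoc (f a) (f b) (f c) ⟩
  f a + (f b + f c)                         ≡⟨ cong₂ (λ x y → f a + (f x + f y)) (punchIn-punchOut a≢b) (punchIn-punchOut a≢c) ⟨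
  f a + (f (punchIn a b′) + f (punchIn a c′)) ≤⟨ +-monoʳ-≤ (f a) (two-terms≤∑ (f ∘ punchIn a) b′≢c′) ⟩
  f a + ∑ (f ∘ punchIn a)                   ≡⟨ sum-remove f ⟨
  ∑ f                                       ∎
  where
  open ≤-Reasoning
  b′ = punchOut a≢b
  c′ = punchOut a≢c
  b′≢c′ : b′ ≢ c′
  b′≢c′ = b≢c ∘ punchOut-injective a≢b a≢c

∑-≤-at : ∀ {k} (f : Fin (suc k) → ℕ) a {U} → (∀ v → v ≢ a → f v ≤ U) → ∑ f ≤ f a + k * U
∑-≤-at {k} f a {U} f≤U = begin
  ∑ f                       ≡⟨ sum-remove f ⟩
  f a + ∑ (f ∘ punchIn a)   ≤⟨ +-monoʳ-≤ (f a) (∑-≤-const (f ∘ punchIn a) (λ i → f≤U _ (punchInᵢ≢i a i))) ⟩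
  f a + k * U               ∎
  where open ≤-Reasoning

∑-≥-at : ∀ {k} (f : Fin (suc k) → ℕ) a {L} → (∀ v → L ≤ f v) → f a + k * L ≤ ∑ f
∑-≥-at {k} f a {L} L≤f = begin
  f a + k * L               ≤⟨ +-monoʳ-≤ (f a) (∑-≥-const (f ∘ punchIn a) (L≤f ∘ punchIn a)) ⟩
  f a + ∑ (f ∘ punchIn a)   ≡⟨ sum-remove f ⟨
  ∑ f                       ∎
  where open ≤-Reasoning

∑-≥-at₂ : ∀ {k} (f : Fin (suc (suc k)) → ℕ) {a b} → a ≢ b → ∀ {L} → (∀ v → L ≤ f v) → f a + f b + k * L ≤ ∑ f
∑-≥-at₂ {k} f {a} {b} a≢b {L} L≤f = begin
  f a + f b + k * L                             ≡⟨ +-assoc (f a) (f b) (k * L) ⟩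
  f a + (f b + k * L)                           ≡⟨ cong (λ x → f a + (f x + k * L)) (punchIn-punchOut a≢b) ⟨
  f a + (f (punchIn a (punchOut a≢b)) + k * L)  ≤⟨ +-monoʳ-≤ (f a) (∑-≥-at (f ∘ punchIn a) (punchOut a≢b) (L≤f ∘ punchIn a)) ⟩
  f a + ∑ (f ∘ punchIn a)                       ≡⟨ sum-remove f ⟨
  ∑ f                                           ∎
  where open ≤-Reasoning

∑-positive : ∀ {k} (f : Fin k → ℕ) → 1 ≤ ∑ f → ∃[ i ] 1 ≤ f i
∑-positive {suc k} f 1≤∑ with 1 ≤? f zero
... | yes 1≤f₀ = zero , 1≤f₀
... | no 1≰f₀ with ∑-positive (f ∘ suc) (subst (λ x → 1 ≤ x + ∑ (f ∘ suc)) (n<1⇒n≡0 (≰⇒> 1≰f₀)) 1≤∑)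
...   | i , 1≤fi = suc i , 1≤fi

∑-agree-except : ∀ {k} {f g : Fin k → ℕ} (i₀ : Fin k) {a b} → (∀ i → i ≢ i₀ → f i ≡ g i) →
                 f i₀ + a ≡ g i₀ + b → ∑ f + a ≡ ∑ g + b
∑-agree-except {suc k} {f} {g} i₀ {a} {b} agree at-i₀ = begin
  ∑ f + a                                ≡⟨ cong (_+ a) (sum-remove f) ⟩
  f i₀ + ∑ (f ∘ punchIn i₀) + a          ≡⟨ cong (λ x → f i₀ + x + a) (sum-cong-≗ (λ i → agree _ (punchInᵢ≢i i₀ i))) ⟩
  f i₀ + ∑ (g ∘ punchIn i₀) + a          ≡⟨ +-comm-middle (f i₀) _ a ⟩
  f i₀ + a + ∑ (g ∘ punchIn i₀)          ≡⟨ cong (_+ ∑ (g ∘ punchIn i₀)) at-i₀ ⟩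
  g i₀ + b + ∑ (g ∘ punchIn i₀)          ≡⟨ +-comm-middle (g i₀) b _ ⟩
  g i₀ + ∑ (g ∘ punchIn i₀) + b          ≡⟨ cong (_+ b) (sum-remove g) ⟨
  ∑ g + b                                ∎
  where
  open ≡-Reasoning
  +-comm-middle : ∀ x y z → x + y + z ≡ x + z + y
  +-comm-middle = solve-∀

-- abstract, since unfolding argmax over allFin makes type checking very slow.
abstract
  heaviest : ∀ {k} (f : Fin (suc k) → ℕ) → ∃[ i ] ∀ j → f j ≤ f i
  heaviest {k} f = argmax f zero (allFin (suc k)) ,
                   λ j → All.lookup (f[xs]≤f[argmax] {f = f} zero (allFin (suc k))) (∈-allFin j)

heaviest-except : ∀ {n} (d : Fin (suc (suc n)) → ℕ) z → ∃[ c′ ] ∀ v → v ≢ z → d v ≤ d (punchIn z c′)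
heaviest-except d z with heaviest (removeAt d z)
... | c′ , max = c′ , λ v v≢z → subst (λ x → d x ≤ d (punchIn z c′)) (punchIn-punchOut (v≢z ∘ sym)) (max _)

[v≟w]≡1 : ∀ {n} {v w : Fin n} → v ≡ w → [ v ≟ w ] ≡ 1
[v≟w]≡1 {v = v} {w} v≡w with v ≟ w
... | yes _   = refl
... | no v≢w  = ⊥-elim (v≢w v≡w)

[v≟v]≡1 : ∀ {n} (v : Fin n) → [ v ≟ v ] ≡ 1
[v≟v]≡1 v = [v≟w]≡1 {v = v} refl

[v≟w]≡0 : ∀ {n} {v w : Fin n} → v ≢ w → [ v ≟ w ] ≡ 0
[v≟w]≡0 {v = v} {w} v≢w with v ≟ w
... | yes v≡w = ⊥-elim (v≢w v≡w)
... | no _    = refl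

1≤[v≟w]⇒v≡w : ∀ {n} {v w : Fin n} → 1 ≤ [ v ≟ w ] → v ≡ w
1≤[v≟w]⇒v≡w {v = v} {w} 1≤ with v ≟ w
... | yes v≡w = v≡w

[f≟f]≡[≟] : ∀ {n k} {f : Fin n → Fin k} → (∀ {a b} → f a ≡ f b → a ≡ b) →
            ∀ v w → [ f v ≟ f w ] ≡ [ v ≟ w ]
[f≟f]≡[≟] {f = f} f-inj v w with v ≟ w
... | yes refl = [v≟v]≡1 (f v)
... | no v≢w   = [v≟w]≡0 (v≢w ∘ f-inj)

∑[v≟a]≡1 : ∀ {n} (a : Fin n) → ∑ (λ v → [ v ≟ a ]) ≡ 1
∑[v≟a]≡1 {suc n} zero    = cong₂ _+_ ([v≟v]≡1 {suc n} zero)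
  (trans (sum-cong-≗ {n} (λ v → [v≟w]≡0 {v = suc v} {zero} λ ())) (trans (∑-const n 0) (*-zeroʳ n)))
∑[v≟a]≡1 {suc n} (suc a) = cong₂ _+_ ([v≟w]≡0 {v = zero} {suc a} λ ())
  (trans (sum-cong-≗ (λ v → [f≟f]≡[≟] fsuc-injective v a)) (∑[v≟a]≡1 a))

module _ {n} (G : Multigraph n) where

  end₁ end₂ : Fin (m G) → Fin n
  end₁ e = proj₁ (ends G e)
  end₂ e = proj₂ (ends G e)

  incidence : Fin n → Fin (m G) → ℕ
  incidence v e = [ v ≟ end₁ e ] + [ v ≟ end₂ e ]

  degree-∑ : ∀ v → degree G v ≡ ∑ (incidence v)
  degree-∑ v = sum-allFin (incidence v)

  incidence≤1 : ∀ v e → incidence v e ≤ 1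
  incidence≤1 v e with v ≟ end₁ e | v ≟ end₂ e
  ... | yes refl | yes v≡end₂ = ⊥-elim (loopless G e v≡end₂)
  ... | yes _    | no _       = ≤-refl
  ... | no _     | yes _      = ≤-refl
  ... | no _     | no _       = z≤n

  degree≤edges : ∀ v → degree G v ≤ m G
  degree≤edges v = begin
    degree G v         ≡⟨ degree-∑ v ⟩
    ∑ (incidence v)    ≤⟨ ∑-≤-const (incidence v) (incidence≤1 v) ⟩
    m G * 1            ≡⟨ *-identityʳ (m G) ⟩
    m G                ∎
    where open ≤-Reasoning

  handshake : ∑ (degree G) ≡ 2 * m G
  handshake = begin
    ∑ (degree G)                                          ≡⟨ sum-cong-≗ degree-∑ ⟩
    ∑ (λ v → ∑ (incidence v))                             ≡⟨ ∑-comm incidence ⟩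
    ∑ (λ e → ∑ (λ v → incidence v e))                     ≡⟨ sum-cong-≗ (λ e → ∑-distrib-+ (λ v → [ v ≟ end₁ e ]) _) ⟩
    ∑ (λ e → ∑ {n} (λ v → [ v ≟ end₁ e ]) + ∑ (λ v → [ v ≟ end₂ e ]))
                                                          ≡⟨ sum-cong-≗ (λ e → cong₂ _+_ (∑[v≟a]≡1 (end₁ e)) (∑[v≟a]≡1 (end₂ e))) ⟩
    ∑ {m G} (λ _ → 2)                                     ≡⟨ ∑-const (m G) 2 ⟩
    m G * 2                                               ≡⟨ *-comm (m G) 2 ⟩
    2 * m G                                               ∎
    where open ≡-Reasoning

  Incident : Fin (m G) → Fin n → Set
  Incident e v = end₁ e ≡ v ⊎ end₂ e ≡ v

  incident⇒1≤incidence : ∀ {e v} → Incident e v → 1 ≤ incidence v e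
  incident⇒1≤incidence {e} {v} (inj₁ refl) =
    subst (λ x → 1 ≤ x + [ v ≟ end₂ e ]) (sym ([v≟v]≡1 v)) (s≤s z≤n)
  incident⇒1≤incidence {e} {v} (inj₂ refl) =
    subst (λ x → 1 ≤ [ v ≟ end₁ e ] + x) (sym ([v≟v]≡1 v)) (m≤n+m 1 _)

  1≤incidence⇒incident : ∀ {e v} → 1 ≤ incidence v e → Incident e v
  1≤incidence⇒incident {e} {v} 1≤ with 1 ≤? [ v ≟ end₁ e ]
  ... | yes 1≤[v≟end₁] = inj₁ (sym (1≤[v≟w]⇒v≡w 1≤[v≟end₁]))
  ... | no 1≰[v≟end₁]  = inj₂ (sym (1≤[v≟w]⇒v≡w
    (subst (λ x → 1 ≤ x + [ v ≟ end₂ e ]) (n<1⇒n≡0 (≰⇒> 1≰[v≟end₁])) 1≤)))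

  1≤degree⇒incident : ∀ {v} → 1 ≤ degree G v → ∃[ e ] Incident e v
  1≤degree⇒incident {v} 1≤deg with ∑-positive (incidence v) (subst (1 ≤_) (degree-∑ v) 1≤deg)
  ... | e , 1≤inc = e , 1≤incidence⇒incident 1≤inc

  incident⇒1≤degree : ∀ {e v} → Incident e v → 1 ≤ degree G v
  incident⇒1≤degree {e} {v} inc = begin
    1                 ≤⟨ incident⇒1≤incidence inc ⟩
    incidence v e     ≤⟨ term≤∑ (incidence v) e ⟩
    ∑ (incidence v)   ≡⟨ degree-∑ v ⟨
    degree G v        ∎
    where open ≤-Reasoning

  leaf-edge-unique : ∀ {v e e′} → degree G v ≡ 1 → Incident e v → Incident e′ v → e ≡ e′
  leaf-edge-unique {v} {e} {e′} deg≡1 inc inc′ with e ≟ e′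
  ... | yes e≡e′ = e≡e′
  ... | no e≢e′  = ⊥-elim (<-irrefl refl (begin-strict
    1                                 <⟨ +-mono-≤ (incident⇒1≤incidence inc) (incident⇒1≤incidence inc′) ⟩
    incidence v e + incidence v e′    ≤⟨ two-terms≤∑ (incidence v) e≢e′ ⟩
    ∑ (incidence v)                   ≡⟨ trans (sym (degree-∑ v)) deg≡1 ⟩
    1                                 ∎))
    where open ≤-Reasoning

edge-reach : ∀ {n} (G : Multigraph n) {S e} → e ∈ S → Reach G S (end₁ G e) (end₂ G e)
edge-reach G e∈S = fwd e∈S here

module _ {n} {G : Multigraph n} where

  Reach-trans : ∀ {S u v w} → Reach G S u v → Reach G S v w → Reach G S u w
  Reach-trans u⇝v here          = u⇝v
  Reach-trans u⇝v (fwd e∈S v⇝w) = fwd e∈S (Reach-trans u⇝v v⇝w)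
  Reach-trans u⇝v (bwd e∈S v⇝w) = bwd e∈S (Reach-trans u⇝v v⇝w)

  Reach-sym : ∀ {S u v} → Reach G S u v → Reach G S v u
  Reach-sym here           = here
  Reach-sym (fwd e∈S u⇝v) = Reach-trans (bwd e∈S here) (Reach-sym u⇝v)
  Reach-sym (bwd e∈S u⇝v) = Reach-trans (fwd e∈S here) (Reach-sym u⇝v)

  Reach-mono : ∀ {S S′} → S ⊆ S′ → ∀ {u v} → Reach G S u v → Reach G S′ u v
  Reach-mono S⊆S′ here          = here
  Reach-mono S⊆S′ (fwd e∈S u⇝v) = fwd (S⊆S′ e∈S) (Reach-mono S⊆S′ u⇝v)
  Reach-mono S⊆S′ (bwd e∈S u⇝v) = bwd (S⊆S′ e∈S) (Reach-mono S⊆S′ u⇝v)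

  Reach-invariant : ∀ {S} {A : Set} (f : Fin n → A) →
                    (∀ {e} → e ∈ S → f (end₁ G e) ≡ f (end₂ G e)) →
                    ∀ {u v} → Reach G S u v → f u ≡ f v
  Reach-invariant f f-const here          = refl
  Reach-invariant f f-const (fwd e∈S u⇝v) = trans (Reach-invariant f f-const u⇝v) (f-const e∈S)
  Reach-invariant f f-const (bwd e∈S u⇝v) = trans (Reach-invariant f f-const u⇝v) (sym (f-const e∈S))

  Reach-bypass : ∀ {S e} → Reach G (S - e) (end₁ G e) (end₂ G e) →
                 ∀ {u v} → Reach G S u v → Reach G (S - e) u v
  Reach-bypass detour here = here
  Reach-bypass {e = e} detour (fwd {f} f∈S u⇝v) with f ≟ e
  ... | yes refl = Reach-trans (Reach-bypass detour u⇝v) detour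
  ... | no f≢e   = fwd (x∈p∧x≢y⇒x∈p-y f∈S f≢e) (Reach-bypass detour u⇝v)
  Reach-bypass {e = e} detour (bwd {f} f∈S u⇝v) with f ≟ e
  ... | yes refl = Reach-trans (Reach-bypass detour u⇝v) (Reach-sym detour)
  ... | no f≢e   = bwd (x∈p∧x≢y⇒x∈p-y f∈S f≢e) (Reach-bypass detour u⇝v)

  last-edge : ∀ {S u v} → Reach G S u v → u ≢ v → ∃[ e ] e ∈ S × Incident G e v
  last-edge here              u≢u = ⊥-elim (u≢u refl)
  last-edge (fwd {e} e∈S _) _   = e , e∈S , inj₂ refl
  last-edge (bwd {e} e∈S _) _   = e , e∈S , inj₁ refl

-- Component labellings and spanning trees

fixedPoints : ∀ {n} → (Fin n → Fin n) → ℕ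
fixedPoints c = ∑ (λ v → [ c v ≟ v ])

-- Each edge of S merges at most two label classes, so a labelling with at least n ∸ ∣ S ∣ fixed
-- points exists; a connected S has at most one fixed label, whence n ≤ 1 + ∣ S ∣.
record ComponentLabelling {n} (G : Multigraph n) (S : Subset (m G)) : Set where
  field
    label       : Fin n → Fin n
    sound       : ∀ {u v} → Reach G S u v → label u ≡ label v
    complete    : ∀ {u v} → label u ≡ label v → Reach G S u v
    n≤fixed+∣S∣ : n ≤ fixedPoints label + ∣ S ∣

module Merge {n} (c : Fin n → Fin n) (a b : Fin n) where

  merged : Fin n → Fin n
  merged v with c v ≟ c b
  ... | yes _ = c a
  ... | no _  = c v

  merged-cong : ∀ {x y} → c x ≡ c y → merged x ≡ merged y
  merged-cong {x} {y} cx≡cy with c x ≟ c b | c y ≟ c b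
  ... | yes _   | yes _   = refl
  ... | yes cx≡ | no cy≢  = ⊥-elim (cy≢ (trans (sym cx≡cy) cx≡))
  ... | no cx≢  | yes cy≡ = ⊥-elim (cx≢ (trans cx≡cy cy≡))
  ... | no _    | no _    = cx≡cy

  merged-a : merged a ≡ c a
  merged-a with c a ≟ c b
  ... | yes _ = refl
  ... | no _  = refl

  merged-b : merged b ≡ c a
  merged-b with c b ≟ c b
  ... | yes _    = refl
  ... | no cb≢cb = ⊥-elim (cb≢cb refl)

  merged-off : ∀ {x} → c x ≢ c b → merged x ≡ c x
  merged-off {x} cx≢ with c x ≟ c b
  ... | yes cx≡ = ⊥-elim (cx≢ cx≡)
  ... | no _    = refl

  merged-inv : ∀ {x y} → merged x ≡ merged y → c x ≡ c y ⊎ (c x ≡ c a × c y ≡ c b) ⊎ (c x ≡ c b × c y ≡ c a)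
  merged-inv {x} {y} eq with c x ≟ c b | c y ≟ c b
  ... | yes cx≡ | yes cy≡ = inj₁ (trans cx≡ (sym cy≡))
  ... | yes cx≡ | no _    = inj₂ (inj₂ (cx≡ , sym eq))
  ... | no _    | yes cy≡ = inj₂ (inj₁ (eq , cy≡))
  ... | no _    | no _    = inj₁ eq

  fixedPoints-merged : fixedPoints c ≤ fixedPoints merged + 1
  fixedPoints-merged = begin
    fixedPoints c                                     ≤⟨ ∑-mono-≤ lost-only-at-cb ⟩
    ∑ (λ v → [ merged v ≟ v ] + [ v ≟ c b ])          ≡⟨ ∑-distrib-+ (λ v → [ merged v ≟ v ]) _ ⟩
    fixedPoints merged + ∑ (λ v → [ v ≟ c b ])        ≡⟨ cong (fixedPoints merged +_) (∑[v≟a]≡1 (c b)) ⟩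
    fixedPoints merged + 1                            ∎
    where
    open ≤-Reasoning
    lost-only-at-cb : ∀ v → [ c v ≟ v ] ≤ [ merged v ≟ v ] + [ v ≟ c b ]
    lost-only-at-cb v with c v ≟ v
    ... | no _     = z≤n
    ... | yes cv≡v = fixed (c v ≟ c b)
      where
      fixed : Dec (c v ≡ c b) → 1 ≤ [ merged v ≟ v ] + [ v ≟ c b ]
      fixed (yes cv≡cb) = ≤-trans (≤-reflexive (sym ([v≟w]≡1 (trans (sym cv≡v) cv≡cb)))) (m≤n+m _ _)
      fixed (no cv≢cb)  = ≤-trans (≤-reflexive (sym ([v≟w]≡1 (trans (merged-off cv≢cb) cv≡v)))) (m≤m+n _ _)

module _ {n} (G : Multigraph n) where

  discreteLabelling : ∀ {S} → (∀ e → e ∉ S) → ComponentLabelling G S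
  discreteLabelling {S} S-empty = record
    { label       = id
    ; sound       = Reach-invariant id (λ {e} e∈S → ⊥-elim (S-empty e e∈S))
    ; complete    = λ { refl → here }
    ; n≤fixed+∣S∣ = begin
        n                  ≡⟨ trans (sym (*-identityʳ n)) (sym (∑-const n 1)) ⟩
        ∑ {n} (λ _ → 1)    ≡⟨ sum-cong-≗ {n} (λ v → sym ([v≟v]≡1 v)) ⟩
        fixedPoints {n} id ≤⟨ m≤m+n _ _ ⟩
        fixedPoints {n} id + ∣ S ∣ ∎
    }
    where open ≤-Reasoning

  mergeLabelling : ∀ {S e} → e ∈ S → ComponentLabelling G (S - e) → ComponentLabelling G S
  mergeLabelling {S} {e} e∈S L = record
    { label       = merged
    ; sound       = Reach-invariant merged merged-const
    ; complete    = complete′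
    ; n≤fixed+∣S∣ = begin
        n                                  ≤⟨ L.n≤fixed+∣S∣ ⟩
        fixedPoints L.label + ∣ S - e ∣    ≤⟨ +-monoˡ-≤ _ fixedPoints-merged ⟩
        fixedPoints merged + 1 + ∣ S - e ∣ ≡⟨ +-assoc (fixedPoints merged) 1 _ ⟩
        fixedPoints merged + suc ∣ S - e ∣ ≤⟨ +-monoʳ-≤ _ (x∈p⇒∣p-x∣<∣p∣ e∈S) ⟩
        fixedPoints merged + ∣ S ∣         ∎
    }
    where
    module L = ComponentLabelling L
    open Merge L.label (end₁ G e) (end₂ G e)
    open ≤-Reasoning

    S-e⊆S : S - e ⊆ S
    S-e⊆S = p─q⊆p S _

    merged-const : ∀ {f} → f ∈ S → merged (end₁ G f) ≡ merged (end₂ G f)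
    merged-const {f} f∈S with f ≟ e
    ... | yes refl = trans merged-a (sym merged-b)
    ... | no f≢e   = merged-cong (L.sound (edge-reach G (x∈p∧x≢y⇒x∈p-y f∈S f≢e)))

    complete′ : ∀ {u v} → merged u ≡ merged v → Reach G S u v
    complete′ eq with merged-inv eq
    ... | inj₁ same = Reach-mono S-e⊆S (L.complete same)
    ... | inj₂ (inj₁ (u∼a , v∼b)) = Reach-trans (Reach-mono S-e⊆S (L.complete u∼a))
      (Reach-trans (edge-reach G e∈S) (Reach-mono S-e⊆S (L.complete (sym v∼b))))
    ... | inj₂ (inj₂ (u∼b , v∼a)) = Reach-trans (Reach-mono S-e⊆S (L.complete u∼b))
      (Reach-trans (Reach-sym (edge-reach G e∈S)) (Reach-mono S-e⊆S (L.complete (sym v∼a))))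

  componentLabelling : ∀ S → ComponentLabelling G S
  componentLabelling S = <-rec P build ∣ S ∣ S refl
    where
    P : ℕ → Set
    P k = ∀ S → ∣ S ∣ ≡ k → ComponentLabelling G S
    build : ∀ k → (∀ {j} → j < k → P j) → P k
    build k ih S refl with nonempty? S
    ... | no S-empty     = discreteLabelling (λ e e∈S → S-empty (e , e∈S))
    ... | yes (e , e∈S) = mergeLabelling e∈S (ih (x∈p⇒∣p-x∣<∣p∣ e∈S) (S - e) refl)

  reach? : ∀ S u v → Dec (Reach G S u v)
  reach? S u v = map′ complete sound (label u ≟ label v)
    where open ComponentLabelling (componentLabelling S)

connected⇒n≤1+∣S∣ : ∀ {n} (G : Multigraph n) {S} → Connected G S → n ≤ suc ∣ S ∣
connected⇒n≤1+∣S∣ {zero}  G conn = z≤n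
connected⇒n≤1+∣S∣ {suc n} G {S} conn = begin
  suc n                          ≤⟨ n≤fixed+∣S∣ ⟩
  fixedPoints label + ∣ S ∣      ≤⟨ +-monoˡ-≤ ∣ S ∣ one-fixed-point ⟩
  suc ∣ S ∣                      ∎
  where
  open ComponentLabelling (componentLabelling G S)
  open ≤-Reasoning
  fixed⇒label₀ : ∀ v → [ label v ≟ v ] ≤ [ v ≟ label zero ]
  fixed⇒label₀ v with label v ≟ v
  ... | no _     = z≤n
  ... | yes lv≡v = ≤-reflexive (sym ([v≟w]≡1 (trans (sym lv≡v) (sound (conn v zero)))))
  one-fixed-point : fixedPoints label ≤ 1
  one-fixed-point = ≤-trans (∑-mono-≤ fixed⇒label₀) (≤-reflexive (∑[v≟a]≡1 (label zero)))

spanningTreeWithin : ∀ {n} (G : Multigraph n) {S} → Connected G S → ∃[ T ] T ⊆ S × SpanningTree G T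
spanningTreeWithin G {S} conn = <-rec P extract ∣ S ∣ S refl conn
  where
  P : ℕ → Set
  P k = ∀ S → ∣ S ∣ ≡ k → Connected G S → ∃[ T ] T ⊆ S × SpanningTree G T
  extract : ∀ k → (∀ {j} → j < k → P j) → P k
  extract k ih S refl conn
    with any? (λ e → (e ∈? S) ×-dec reach? G (S - e) (end₁ G e) (end₂ G e))
  ... | no acyclic = S , id , conn , λ e e∈S detour → acyclic (e , e∈S , detour)
  ... | yes (e , e∈S , detour) with ih (x∈p⇒∣p-x∣<∣p∣ e∈S) (S - e) refl (λ u v → Reach-bypass detour (conn u v))
  ...   | T , T⊆S-e , tree = T , p─q⊆p S _ ∘ T⊆S-e , tree

∣p∣+∣q∣≡∣p∪q∣+∣p∩q∣ : ∀ {k} (p q : Subset k) → ∣ p ∣ + ∣ q ∣ ≡ ∣ p ∪ q ∣ + ∣ p ∩ q ∣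
∣p∣+∣q∣≡∣p∪q∣+∣p∩q∣ []            []            = refl
∣p∣+∣q∣≡∣p∪q∣+∣p∩q∣ (false ∷ p) (false ∷ q) = ∣p∣+∣q∣≡∣p∪q∣+∣p∩q∣ p q
∣p∣+∣q∣≡∣p∪q∣+∣p∩q∣ (false ∷ p) (true ∷ q)  = trans (+-suc ∣ p ∣ ∣ q ∣) (cong suc (∣p∣+∣q∣≡∣p∪q∣+∣p∩q∣ p q))
∣p∣+∣q∣≡∣p∪q∣+∣p∩q∣ (true ∷ p)  (false ∷ q) = cong suc (∣p∣+∣q∣≡∣p∪q∣+∣p∩q∣ p q)
∣p∣+∣q∣≡∣p∪q∣+∣p∩q∣ (true ∷ p)  (true ∷ q)  =
  cong suc (trans (+-suc ∣ p ∣ ∣ q ∣) (trans (cong suc (∣p∣+∣q∣≡∣p∪q∣+∣p∩q∣ p q)) (sym (+-suc _ _))))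

two-elements⇒2≤∣p∣ : ∀ {k} {p : Subset k} {x y} → x ∈ p → y ∈ p → x ≢ y → 2 ≤ ∣ p ∣
two-elements⇒2≤∣p∣ {p = p} {x} {y} x∈p y∈p x≢y = begin
  2                 ≤⟨ s≤s (s≤s z≤n) ⟩
  suc (suc ∣ p - x - y ∣) ≤⟨ s≤s (x∈p⇒∣p-x∣<∣p∣ (x∈p∧x≢y⇒x∈p-y y∈p (x≢y ∘ sym))) ⟩
  suc ∣ p - x ∣      ≤⟨ x∈p⇒∣p-x∣<∣p∣ x∈p ⟩
  ∣ p ∣              ∎
  where open ≤-Reasoning

overlapping-connectors⇒2n≤m+k+2 : ∀ {n k} (G : Multigraph n) {S₁ S₂} → Connected G S₁ → Connected G S₂ →
                                  ∣ S₁ ∩ S₂ ∣ ≤ k → 2 * n ≤ m G + k + 2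
overlapping-connectors⇒2n≤m+k+2 {n} {k} G {S₁} {S₂} conn₁ conn₂ shared = begin
  2 * n                                 ≡⟨ cong (n +_) (+-identityʳ n) ⟩
  n + n                                 ≤⟨ +-mono-≤ (connected⇒n≤1+∣S∣ G conn₁) (connected⇒n≤1+∣S∣ G conn₂) ⟩
  suc ∣ S₁ ∣ + suc ∣ S₂ ∣               ≡⟨ cong suc (+-suc ∣ S₁ ∣ ∣ S₂ ∣) ⟩
  2 + (∣ S₁ ∣ + ∣ S₂ ∣)                 ≡⟨ cong (2 +_) (∣p∣+∣q∣≡∣p∪q∣+∣p∩q∣ S₁ S₂) ⟩
  2 + (∣ S₁ ∪ S₂ ∣ + ∣ S₁ ∩ S₂ ∣)       ≤⟨ +-monoʳ-≤ 2 (+-mono-≤ (∣p∣≤n (S₁ ∪ S₂)) shared) ⟩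
  2 + (m G + k)                         ≡⟨ +-comm 2 _ ⟩
  m G + k + 2                           ∎
  where open ≤-Reasoning

module _ {n} (G : Multigraph n) where

  leaf-edge-shared : ∀ {S₁ S₂} → Connected G S₁ → Connected G S₂ → ∀ {w v} → w ≢ v → degree G v ≡ 1 →
                     ∃[ e ] e ∈ S₁ ∩ S₂ × Incident G e v
  leaf-edge-shared conn₁ conn₂ {w} {v} w≢v leaf
    with last-edge (conn₁ w v) w≢v | last-edge (conn₂ w v) w≢v
  ... | e₁ , e₁∈S₁ , inc₁ | e₂ , e₂∈S₂ , inc₂ with leaf-edge-unique G leaf inc₁ inc₂
  ...   | refl = e₁ , x∈p∩q⁺ (e₁∈S₁ , e₂∈S₂) , inc₁

  module _ {x y} (x≢y : x ≢ y) (leaf-x : degree G x ≡ 1) (leaf-y : degree G y ≡ 1) where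

    private
      Leaf : Fin n → Set
      Leaf v = v ≡ x ⊎ v ≡ y

    ends-leaves : ∀ {e} → Incident G e x → Incident G e y → Leaf (end₁ G e) × Leaf (end₂ G e)
    ends-leaves (inj₁ e₁≡x) (inj₁ e₁≡y) = ⊥-elim (x≢y (trans (sym e₁≡x) e₁≡y))
    ends-leaves (inj₁ e₁≡x) (inj₂ e₂≡y) = inj₁ e₁≡x , inj₂ e₂≡y
    ends-leaves (inj₂ e₂≡x) (inj₁ e₁≡y) = inj₂ e₁≡y , inj₁ e₂≡x
    ends-leaves (inj₂ e₂≡x) (inj₂ e₂≡y) = ⊥-elim (x≢y (trans (sym e₂≡x) e₂≡y))

    module _ {e} (e-at-x : Incident G e x) (e-at-y : Incident G e y) where

      only-edge-at-leaves : ∀ {f v} → Leaf v → Incident G f v → f ≡ e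
      only-edge-at-leaves (inj₁ refl) f-at-x = leaf-edge-unique G leaf-x f-at-x e-at-x
      only-edge-at-leaves (inj₂ refl) f-at-y = leaf-edge-unique G leaf-y f-at-y e-at-y

      joined-leaves-isolated : ∀ {S u v} → Reach G S u v → Leaf v → Leaf u
      joined-leaves-isolated here leaf-v = leaf-v
      joined-leaves-isolated (fwd _ u⇝) leaf-v with only-edge-at-leaves leaf-v (inj₂ refl)
      ... | refl = joined-leaves-isolated u⇝ (proj₁ (ends-leaves e-at-x e-at-y))
      joined-leaves-isolated (bwd _ u⇝) leaf-v with only-edge-at-leaves leaf-v (inj₁ refl)
      ... | refl = joined-leaves-isolated u⇝ (proj₂ (ends-leaves e-at-x e-at-y))

    two-leaves⇒2≤∣S₁∩S₂∣ : ∀ {S₁ S₂} → Connected G S₁ → Connected G S₂ →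
                            ∀ {w} → w ≢ x → w ≢ y → 2 ≤ ∣ S₁ ∩ S₂ ∣
    two-leaves⇒2≤∣S₁∩S₂∣ conn₁ conn₂ {w} w≢x w≢y
      with leaf-edge-shared conn₁ conn₂ w≢x leaf-x | leaf-edge-shared conn₁ conn₂ w≢y leaf-y
    ... | e , e∈ , e-at-x | f , f∈ , f-at-y with e ≟ f
    ...   | no e≢f  = two-elements⇒2≤∣p∣ e∈ f∈ e≢f
    ...   | yes refl with joined-leaves-isolated e-at-x f-at-y (conn₁ w x) (inj₁ refl)
    ...     | inj₁ w≡x = ⊥-elim (w≢x w≡x)
    ...     | inj₂ w≡y = ⊥-elim (w≢y w≡y)

EndDegrees : (n : ℕ) → (Fin n → ℕ) → Set
EndDegrees n d = (∀ (i : Fin n) → toℕ i + 2 ≡ n → 2 ≤ d i) × (∀ (i : Fin n) → toℕ i + 1 ≡ n → 1 ≤ d i)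

DegreeCondition : (n : ℕ) → (Fin n → ℕ) → Set
DegreeCondition n d = (4 * n ≤ Σd d + 6) × ((n ≤ 2) ⊎ ((n > 2) × EndDegrees n d))

TwoTreeRealization : (n : ℕ) → (Fin n → ℕ) → Set
TwoTreeRealization n d = Σ (Multigraph n) (λ G → Realizes G d × TwoTreesShareAtMostOne G)

realization-∑ : ∀ {n} {d : Fin n → ℕ} (G : Multigraph n) → Realizes G d → ∑ d ≡ 2 * m G
realization-∑ G real = trans (sum-cong-≗ (sym ∘ real)) (handshake G)

realization-≤ : ∀ {n} {d : Fin n → ℕ} (G : Multigraph n) → Realizes G d → ∀ v → d v ≤ m G
realization-≤ G real v = subst (_≤ m G) (real v) (degree≤edges G v)

toℕ-≢ : ∀ {n} {i j : Fin n} → toℕ i ≢ toℕ j → i ≢ j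
toℕ-≢ toℕi≢toℕj refl = toℕi≢toℕj refl

end-degrees : ∀ {n} {d : Fin n → ℕ} (G : Multigraph n) {S₁ S₂} → NonIncreasing d → Realizes G d →
              Connected G S₁ → Connected G S₂ → ∣ S₁ ∩ S₂ ∣ ≤ 1 → n > 2 → EndDegrees n d
end-degrees {suc n} {d} G noninc real conn₁ conn₂ shared (s≤s 2≤n) = second-last , last
  where
  last : ∀ i → toℕ i + 1 ≡ suc n → 1 ≤ d i
  last i i+1≡ = subst (1 ≤_) (real i) (incident⇒1≤degree G (proj₂ (proj₂ (last-edge (conn₁ zero i) 0≢i))))
    where
    0≢i : zero ≢ i
    0≢i = toℕ-≢ λ 0≡i → <⇒≢ (≤-trans (n≤1+n 1) 2≤n) (suc-injective (trans (cong (_+ 1) 0≡i) i+1≡))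
  second-last : ∀ x → toℕ x + 2 ≡ suc n → 2 ≤ d x
  second-last x x+2≡ with 2 ≤? d x
  ... | yes 2≤dx = 2≤dx
  ... | no 2≰dx  = ⊥-elim (<-irrefl refl (≤-trans
        (two-leaves⇒2≤∣S₁∩S₂∣ G x≢y (leaf x dx≡1) (leaf y dy≡1) conn₁ conn₂ 0≢x 0≢y) shared))
    where
    x+1<1+n : suc (toℕ x) < suc n
    x+1<1+n = ≤-reflexive (trans (+-comm 2 (toℕ x)) x+2≡)
    y : Fin (suc n)
    y = fromℕ< x+1<1+n
    toℕy : toℕ y ≡ suc (toℕ x)
    toℕy = toℕ-fromℕ< x+1<1+n
    x≢y : x ≢ y
    x≢y = toℕ-≢ λ eq → 1+n≢n (sym (trans eq toℕy))
    0≢x : zero ≢ x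
    0≢x = toℕ-≢ λ 0≡x → <⇒≢ 2≤n (suc-injective (trans (cong (_+ 2) 0≡x) x+2≡))
    0≢y : zero ≢ y
    0≢y = toℕ-≢ λ 0≡y → 0≢1+n (trans 0≡y toℕy)
    dy≤dx : d y ≤ d x
    dy≤dx = noninc x y (≤-trans (n≤1+n (toℕ x)) (≤-reflexive (sym toℕy)))
    1≤dy : 1 ≤ d y
    1≤dy = last y (trans (cong (_+ 1) toℕy) (trans (sym (+-suc (toℕ x) 1)) x+2≡))
    dx≡1 : d x ≡ 1
    dx≡1 = ≤-antisym (≤-pred (≰⇒> 2≰dx)) (≤-trans 1≤dy dy≤dx)
    dy≡1 : d y ≡ 1
    dy≡1 = ≤-antisym (≤-trans dy≤dx (≤-pred (≰⇒> 2≰dx))) 1≤dy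
    leaf : ∀ v → d v ≡ 1 → degree G v ≡ 1
    leaf v dv≡1 = trans (real v) dv≡1

necessity : ∀ {n} {d : Fin n → ℕ} → NonIncreasing d → TwoTreeRealization n d → DegreeCondition n d
necessity {n} {d} noninc (G , real , T₁ , T₂ , (conn₁ , _) , (conn₂ , _) , shared) = sum-bound , small-or-end-degrees
  where
  sum-bound : 4 * n ≤ Σd d + 6
  sum-bound = begin
    4 * n             ≡⟨ *-assoc 2 2 n ⟩
    2 * (2 * n)       ≤⟨ *-monoʳ-≤ 2 (overlapping-connectors⇒2n≤m+k+2 G conn₁ conn₂ shared) ⟩
    2 * (m G + 1 + 2) ≡⟨ 2[x+1+2]≡2x+6 (m G) ⟩
    2 * m G + 6       ≡⟨ cong (_+ 6) (trans (sum-allFin d) (realization-∑ G real)) ⟨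
    Σd d + 6          ∎
    where
    open ≤-Reasoning
    2[x+1+2]≡2x+6 : ∀ x → 2 * (x + 1 + 2) ≡ 2 * x + 6
    2[x+1+2]≡2x+6 = solve-∀
  small-or-end-degrees : (n ≤ 2) ⊎ ((n > 2) × EndDegrees n d)
  small-or-end-degrees with n ≤? 2
  ... | yes n≤2 = inj₁ n≤2
  ... | no n≰2  = inj₂ (≰⇒> n≰2 , end-degrees G noninc real conn₁ conn₂ shared (≰⇒> n≰2))

-- Attaching a new vertex

module _ {n} (G : Multigraph n) where

  addEdge : (u w : Fin n) → u ≢ w → Multigraph n
  addEdge u w u≢w = record
    { m        = suc (m G)
    ; ends     = λ { zero → u , w ; (suc e) → ends G e }
    ; loopless = λ { zero → u≢w ; (suc e) → loopless G e }
    }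

  degree-addEdge : ∀ {u w} (u≢w : u ≢ w) v → degree (addEdge u w u≢w) v ≡ [ v ≟ u ] + [ v ≟ w ] + degree G v
  degree-addEdge u≢w v = trans (degree-∑ (addEdge _ _ u≢w) v) (cong (_ +_) (sym (degree-∑ G v)))

  Reach-addEdge : ∀ {u w} (u≢w : u ≢ w) {S b x y} → Reach G S x y → Reach (addEdge u w u≢w) (b ∷ S) x y
  Reach-addEdge u≢w here          = here
  Reach-addEdge u≢w (fwd e∈S x⇝y) = fwd (there e∈S) (Reach-addEdge u≢w x⇝y)
  Reach-addEdge u≢w (bwd e∈S x⇝y) = bwd (there e∈S) (Reach-addEdge u≢w x⇝y)

  insertVertex : Fin (suc n) → Multigraph (suc n)
  insertVertex z = record
    { m        = m G
    ; ends     = λ e → punchIn z (end₁ G e) , punchIn z (end₂ G e)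
    ; loopless = λ e eq → loopless G e (punchIn-injective z _ _ eq)
    }

  degree-insertVertex : ∀ z v → degree (insertVertex z) (punchIn z v) ≡ degree G v
  degree-insertVertex z v = begin
    degree (insertVertex z) (punchIn z v)          ≡⟨ degree-∑ (insertVertex z) (punchIn z v) ⟩
    ∑ (incidence (insertVertex z) (punchIn z v))   ≡⟨ sum-cong-≗ (λ e → cong₂ _+_ (punchIn-[≟] _) (punchIn-[≟] (end₂ G e))) ⟩
    ∑ (incidence G v)                              ≡⟨ degree-∑ G v ⟨
    degree G v                                     ∎
    where
    open ≡-Reasoning
    punchIn-[≟] : ∀ w → [ punchIn z v ≟ punchIn z w ] ≡ [ v ≟ w ]
    punchIn-[≟] = [f≟f]≡[≟] (punchIn-injective z _ _) v

  degree-insertVertex-new : ∀ z → degree (insertVertex z) z ≡ 0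
  degree-insertVertex-new z = begin
    degree (insertVertex z) z          ≡⟨ degree-∑ (insertVertex z) z ⟩
    ∑ (incidence (insertVertex z) z)   ≡⟨ sum-cong-≗ (λ e → cong₂ _+_ (fresh (end₁ G e)) (fresh (end₂ G e))) ⟩
    ∑ {m G} (λ _ → 0)                  ≡⟨ trans (∑-const (m G) 0) (*-zeroʳ (m G)) ⟩
    0                                  ∎
    where
    open ≡-Reasoning
    fresh : ∀ w → [ z ≟ punchIn z w ] ≡ 0
    fresh w = [v≟w]≡0 (punchInᵢ≢i z w ∘ sym)

module Redirect {n} (G : Multigraph n) (e₀ : Fin (m G)) {v w : Fin n}
                (e₀-at-v : Incident G e₀ v) (w-fresh : ¬ Incident G e₀ w) where

  shift : Fin n → Fin n
  shift x with x ≟ v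
  ... | yes _ = w
  ... | no _  = x

  shift-v : shift v ≡ w
  shift-v with v ≟ v
  ... | yes _  = refl
  ... | no v≢v = ⊥-elim (v≢v refl)

  shift-other : ∀ {x} → x ≢ v → shift x ≡ x
  shift-other {x} x≢v with x ≟ v
  ... | yes x≡v = ⊥-elim (x≢v x≡v)
  ... | no _    = refl

  shift-cases : ∀ x → (x ≡ v × shift x ≡ w) ⊎ shift x ≡ x
  shift-cases x with x ≟ v
  ... | yes x≡v = inj₁ (x≡v , refl)
  ... | no _    = inj₂ refl

  private
    a = end₁ G e₀
    b = end₂ G e₀

  moved-ends : (a ≡ v × shift a ≡ w × shift b ≡ b) ⊎ (b ≡ v × shift a ≡ a × shift b ≡ w)
  moved-ends = Sum.map
    (λ a≡v → a≡v , trans (cong shift a≡v) shift-v , shift-other λ b≡v → loopless G e₀ (trans a≡v (sym b≡v)))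
    (λ b≡v → b≡v , shift-other (λ a≡v → loopless G e₀ (trans a≡v (sym b≡v))) , trans (cong shift b≡v) shift-v)
    e₀-at-v

  redirected-ends : Fin (m G) → Fin n × Fin n
  redirected-ends e with e ≟ e₀
  ... | yes _ = shift a , shift b
  ... | no _  = ends G e

  redirected-ends-e₀ : redirected-ends e₀ ≡ (shift a , shift b)
  redirected-ends-e₀ with e₀ ≟ e₀
  ... | yes _    = refl
  ... | no e₀≢e₀ = ⊥-elim (e₀≢e₀ refl)

  redirected-ends-other : ∀ {e} → e ≢ e₀ → redirected-ends e ≡ ends G e
  redirected-ends-other {e} e≢e₀ with e ≟ e₀
  ... | yes e≡e₀ = ⊥-elim (e≢e₀ e≡e₀)
  ... | no _     = refl

  redirected : Multigraph n
  redirected = record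
    { m        = m G
    ; ends     = redirected-ends
    ; loopless = loopless′
    }
    where
    loopless′ : ∀ e → proj₁ (redirected-ends e) ≢ proj₂ (redirected-ends e)
    loopless′ e with e ≟ e₀
    ... | no _  = loopless G e
    ... | yes _ with moved-ends
    ...   | inj₁ (_ , ma≡w , mb≡b) = λ eq → w-fresh (inj₂ (trans (sym mb≡b) (trans (sym eq) ma≡w)))
    ...   | inj₂ (_ , ma≡a , mb≡w) = λ eq → w-fresh (inj₁ (trans (sym ma≡a) (trans eq mb≡w)))

  degree-redirected : ∀ x → degree redirected x + [ x ≟ v ] ≡ degree G x + [ x ≟ w ]
  degree-redirected x = begin
    degree redirected x + [ x ≟ v ]        ≡⟨ cong (_+ [ x ≟ v ]) (degree-∑ redirected x) ⟩
    ∑ (incidence redirected x) + [ x ≟ v ] ≡⟨ ∑-agree-except e₀ unchanged at-e₀ ⟩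
    ∑ (incidence G x) + [ x ≟ w ]          ≡⟨ cong (_+ [ x ≟ w ]) (degree-∑ G x) ⟨
    degree G x + [ x ≟ w ]                 ∎
    where
    open ≡-Reasoning
    incidence-at : Fin n × Fin n → ℕ
    incidence-at (p , q) = [ x ≟ p ] + [ x ≟ q ]
    unchanged : ∀ e → e ≢ e₀ → incidence redirected x e ≡ incidence G x e
    unchanged e e≢e₀ = cong incidence-at (redirected-ends-other e≢e₀)
    swap-ends : ∀ p q r → p + q + r ≡ r + q + p
    swap-ends = solve-∀
    swap-last : ∀ p q r → p + q + r ≡ p + r + q
    swap-last = solve-∀
    at-e₀ : incidence redirected x e₀ + [ x ≟ v ] ≡ incidence G x e₀ + [ x ≟ w ]
    at-e₀ with redirected-ends e₀ | redirected-ends-e₀ | moved-ends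
    ... | _ | refl | inj₁ (a≡v , ma≡w , mb≡b) = begin
      [ x ≟ shift a ] + [ x ≟ shift b ] + [ x ≟ v ] ≡⟨ cong₂ (λ p q → [ x ≟ p ] + [ x ≟ q ] + [ x ≟ v ]) ma≡w mb≡b ⟩
      [ x ≟ w ] + [ x ≟ b ] + [ x ≟ v ]           ≡⟨ cong (λ p → [ x ≟ w ] + [ x ≟ b ] + [ x ≟ p ]) (sym a≡v) ⟩
      [ x ≟ w ] + [ x ≟ b ] + [ x ≟ a ]           ≡⟨ swap-ends [ x ≟ w ] [ x ≟ b ] [ x ≟ a ] ⟩
      [ x ≟ a ] + [ x ≟ b ] + [ x ≟ w ]           ∎
    ... | _ | refl | inj₂ (b≡v , ma≡a , mb≡w) = begin
      [ x ≟ shift a ] + [ x ≟ shift b ] + [ x ≟ v ] ≡⟨ cong₂ (λ p q → [ x ≟ p ] + [ x ≟ q ] + [ x ≟ v ]) ma≡a mb≡w ⟩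
      [ x ≟ a ] + [ x ≟ w ] + [ x ≟ v ]           ≡⟨ cong (λ p → [ x ≟ a ] + [ x ≟ w ] + [ x ≟ p ]) (sym b≡v) ⟩
      [ x ≟ a ] + [ x ≟ w ] + [ x ≟ b ]           ≡⟨ swap-last [ x ≟ a ] [ x ≟ w ] [ x ≟ b ] ⟩
      [ x ≟ a ] + [ x ≟ b ] + [ x ≟ w ]           ∎

module _ {n n′} {F : Multigraph n} {S : Subset (m F)} {G : Multigraph n′} {S′ : Subset (m G)}
         (R : Fin n → Fin n′ → Set)
         (R-total : ∀ x → ∃ (R x))
         (R-fibres : ∀ {x y x′} → R x x′ → R y x′ → Reach F S x y)
         (R-edges : ∀ {e′} → e′ ∈ S′ → ∃[ e ] e ∈ S × R (end₁ F e) (end₁ G e′) × R (end₂ F e) (end₂ G e′))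
         where

  Reach-pullback : ∀ {x′ y′} → Reach G S′ x′ y′ → ∀ {x y} → R x x′ → R y y′ → Reach F S x y
  Reach-pullback here x∼ y∼ = R-fibres x∼ y∼
  Reach-pullback (fwd e′∈S′ x′⇝) x∼ y∼ with R-edges e′∈S′
  ... | e , e∈S , e₁∼ , e₂∼ = Reach-trans (fwd e∈S (Reach-pullback x′⇝ x∼ e₁∼)) (R-fibres e₂∼ y∼)
  Reach-pullback (bwd e′∈S′ x′⇝) x∼ y∼ with R-edges e′∈S′
  ... | e , e∈S , e₁∼ , e₂∼ = Reach-trans (bwd e∈S (Reach-pullback x′⇝ x∼ e₂∼)) (R-fibres e₁∼ y∼)

  connected-pullback : Connected G S′ → Connected F S
  connected-pullback conn x y = Reach-pullback (conn (proj₁ (R-total x)) (proj₁ (R-total y)))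
                                               (proj₂ (R-total x)) (proj₂ (R-total y))

data Around {n} (z : Fin (suc n)) (c′ : Fin n) : Fin (suc n) → Set where
  at-z      : Around z c′ z
  at-c      : Around z c′ (punchIn z c′)
  elsewhere : ∀ i → i ≢ c′ → Around z c′ (punchIn z i)

around : ∀ {n} (z : Fin (suc n)) (c′ : Fin n) x → Around z c′ x
around z c′ x with z ≟ x
... | yes refl = at-z
... | no z≢x with punchOut z≢x ≟ c′
...   | yes refl = subst (Around z c′) (punchIn-punchOut z≢x) at-c
...   | no i≢c′  = subst (Around z c′) (punchIn-punchOut z≢x) (elsewhere _ i≢c′)

data Redirection {n} (G : Multigraph n) (v : Fin n) : ℕ → Set where
  keep : Redirection G v 0
  move : ∀ e → Incident G e v → Redirection G v 1

redirection : ∀ {n} (G : Multigraph n) {v} r → r ≤ 1 → r ≤ degree G v → Redirection G v r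
redirection G zero      _         _     = keep
redirection G {v} (suc .0) (s≤s z≤n) 1≤deg with 1≤degree⇒incident G {v} 1≤deg
... | e , e-at-v = move e e-at-v

module _ {n} (G : Multigraph n) {u w : Fin n} (u≢w : u ≢ w) where

  addEdges : ℕ → Multigraph n
  addEdges zero    = G
  addEdges (suc j) = addEdge (addEdges j) u w u≢w

  degree-addEdges : ∀ j v → degree (addEdges j) v ≡ j * ([ v ≟ u ] + [ v ≟ w ]) + degree G v
  degree-addEdges zero    v = refl
  degree-addEdges (suc j) v = trans (degree-addEdge (addEdges j) u≢w v)
    (trans (cong ([ v ≟ u ] + [ v ≟ w ] +_) (degree-addEdges j v))
           (sym (+-assoc ([ v ≟ u ] + [ v ≟ w ]) (j * _) (degree G v))))

module Pendant {n} (G : Multigraph n) (z : Fin (suc n)) (c′ : Fin n) where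

  c : Fin (suc n)
  c = punchIn z c′

  c≢z : c ≢ z
  c≢z = punchInᵢ≢i z c′

  private
    H₀ : Multigraph (suc n)
    H₀ = insertVertex G z

    z-fresh : ∀ e → ¬ Incident H₀ e z
    z-fresh e (inj₁ eq) = punchInᵢ≢i z _ eq
    z-fresh e (inj₂ eq) = punchInᵢ≢i z _ eq

    [z≟c]≡0 : [ z ≟ c ] ≡ 0
    [z≟c]≡0 = [v≟w]≡0 (c≢z ∘ sym)

    [c≟z]≡0 : [ c ≟ z ] ≡ 0
    [c≟z]≡0 = [v≟w]≡0 c≢z

    module Moved {e₀} (e₀-at-c′ : Incident G e₀ c′) =
      Redirect H₀ e₀ (Sum.map (cong (punchIn z)) (cong (punchIn z)) e₀-at-c′) (z-fresh e₀)

  -- Built field by field so that m (base ρ) is m G definitionally, whatever ρ is.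
  base : ∀ {r} → Redirection G c′ r → Multigraph (suc n)
  base ρ = record { m = m G ; ends = base-ends ρ ; loopless = base-loopless ρ }
    where
    base-ends : ∀ {r} → Redirection G c′ r → Fin (m G) → Fin (suc n) × Fin (suc n)
    base-ends keep                = ends H₀
    base-ends (move e₀ e₀-at-c′) = ends (Moved.redirected e₀-at-c′)
    base-loopless : ∀ {r} (ρ : Redirection G c′ r) e → proj₁ (base-ends ρ e) ≢ proj₂ (base-ends ρ e)
    base-loopless keep                = loopless H₀
    base-loopless (move e₀ e₀-at-c′) = loopless (Moved.redirected e₀-at-c′)

  degree-base-z : ∀ {r} (ρ : Redirection G c′ r) → degree (base ρ) z ≡ r
  degree-base-z keep                = degree-insertVertex-new G z
  degree-base-z (move e₀ e₀-at-c′) = +-cancelʳ-≡ 0 _ _ (begin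
    degree (base (move e₀ e₀-at-c′)) z + 0         ≡⟨ cong (degree (base (move e₀ e₀-at-c′)) z +_) [z≟c]≡0 ⟨
    degree (base (move e₀ e₀-at-c′)) z + [ z ≟ c ] ≡⟨ Moved.degree-redirected e₀-at-c′ z ⟩
    degree H₀ z + [ z ≟ z ]                         ≡⟨ cong₂ _+_ (degree-insertVertex-new G z) ([v≟v]≡1 z) ⟩
    1                                               ∎)
    where open ≡-Reasoning

  degree-base-c : ∀ {r} (ρ : Redirection G c′ r) → degree (base ρ) c + r ≡ degree G c′
  degree-base-c keep                = trans (+-identityʳ _) (degree-insertVertex G z c′)
  degree-base-c (move e₀ e₀-at-c′) = begin
    degree (base (move e₀ e₀-at-c′)) c + 1         ≡⟨ cong (degree (base (move e₀ e₀-at-c′)) c +_) ([v≟v]≡1 c) ⟨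
    degree (base (move e₀ e₀-at-c′)) c + [ c ≟ c ] ≡⟨ Moved.degree-redirected e₀-at-c′ c ⟩
    degree H₀ c + [ c ≟ z ]                         ≡⟨ cong₂ _+_ (degree-insertVertex G z c′) [c≟z]≡0 ⟩
    degree G c′ + 0                                 ≡⟨ +-identityʳ _ ⟩
    degree G c′                                     ∎
    where open ≡-Reasoning

  degree-base-elsewhere : ∀ {r} (ρ : Redirection G c′ r) {i} → i ≢ c′ → degree (base ρ) (punchIn z i) ≡ degree G i
  degree-base-elsewhere keep                {i} _    = degree-insertVertex G z i
  degree-base-elsewhere (move e₀ e₀-at-c′) {i} i≢c′ = +-cancelʳ-≡ 0 _ _ (begin
    degree (base (move e₀ e₀-at-c′)) x + 0         ≡⟨ cong (degree (base (move e₀ e₀-at-c′)) x +_) [x≟c]≡0 ⟨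
    degree (base (move e₀ e₀-at-c′)) x + [ x ≟ c ] ≡⟨ Moved.degree-redirected e₀-at-c′ x ⟩
    degree H₀ x + [ x ≟ z ]                         ≡⟨ cong₂ _+_ (degree-insertVertex G z i) ([v≟w]≡0 (punchInᵢ≢i z i)) ⟩
    degree G i + 0                                  ∎)
    where
    open ≡-Reasoning
    x = punchIn z i
    [x≟c]≡0 : [ x ≟ c ] ≡ 0
    [x≟c]≡0 = [v≟w]≡0 (i≢c′ ∘ punchIn-injective z i c′)

  Glued : Fin (suc n) → Fin n → Set
  Glued x x′ = x ≡ punchIn z x′ ⊎ (x ≡ z × x′ ≡ c′)

  glued-total : ∀ x → ∃ (Glued x)
  glued-total x with around z c′ x
  ... | at-z          = c′ , inj₂ (refl , refl)
  ... | at-c          = c′ , inj₁ refl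
  ... | elsewhere i _ = i , inj₁ refl

  glued-ends : ∀ {r} (ρ : Redirection G c′ r) e →
               Glued (end₁ (base ρ) e) (end₁ G e) × Glued (end₂ (base ρ) e) (end₂ G e)
  glued-ends keep                e = inj₁ refl , inj₁ refl
  glued-ends (move e₀ e₀-at-c′) e = by-cases (e ≟ e₀)
    where
    open Moved e₀-at-c′
    Glued-ends : Fin (m G) → Fin (suc n) × Fin (suc n) → Set
    Glued-ends e (p , q) = Glued p (end₁ G e) × Glued q (end₂ G e)
    glued-shift : ∀ a → Glued (shift (punchIn z a)) a
    glued-shift a with shift-cases (punchIn z a)
    ... | inj₁ (pa≡c , shifted) = inj₂ (shifted , punchIn-injective z a c′ pa≡c)
    ... | inj₂ unshifted        = inj₁ unshifted
    by-cases : Dec (e ≡ e₀) → Glued-ends e (redirected-ends e)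
    by-cases (yes refl) = subst (Glued-ends e) (sym redirected-ends-e₀)
                                (glued-shift (end₁ G e) , glued-shift (end₂ G e))
    by-cases (no e≢e₀)  = subst (Glued-ends e) (sym (redirected-ends-other e≢e₀)) (inj₁ refl , inj₁ refl)

  glued-fibres : ∀ {F : Multigraph (suc n)} {S} → Reach F S c z →
                 ∀ {x y x′} → Glued x x′ → Glued y x′ → Reach F S x y
  glued-fibres c⇝z (inj₁ refl)           (inj₁ refl)           = here
  glued-fibres c⇝z (inj₁ refl)           (inj₂ (refl , refl))  = c⇝z
  glued-fibres c⇝z (inj₂ (refl , refl))  (inj₁ refl)           = Reach-sym c⇝z
  glued-fibres c⇝z (inj₂ (refl , _))     (inj₂ (refl , _))     = here

  realizes-attached : ∀ {r} (ρ : Redirection G c′ r) j {d′ : Fin n → ℕ} {d : Fin (suc n) → ℕ} → Realizes G d′ →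
                      d z ≡ j + r → d c + r ≡ d′ c′ + j → (∀ i → i ≢ c′ → d (punchIn z i) ≡ d′ i) →
                      Realizes (addEdges (base ρ) c≢z j) d
  realizes-attached {r} ρ j {d′} {d} real dz dc d-elsewhere x with around z c′ x
  ... | at-z = begin
    degree (addEdges (base ρ) c≢z j) z               ≡⟨ degree-addEdges (base ρ) c≢z j z ⟩
    j * ([ z ≟ c ] + [ z ≟ z ]) + degree (base ρ) z  ≡⟨ cong₂ (λ p q → j * (p + q) + degree (base ρ) z) [z≟c]≡0 ([v≟v]≡1 z) ⟩
    j * 1 + degree (base ρ) z                        ≡⟨ cong₂ _+_ (*-identityʳ j) (degree-base-z ρ) ⟩
    j + r                                            ≡⟨ dz ⟨
    d z                                              ∎
    where open ≡-Reasoning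
  ... | at-c = +-cancelʳ-≡ r _ _ (begin
    degree (addEdges (base ρ) c≢z j) c + r                 ≡⟨ cong (_+ r) (degree-addEdges (base ρ) c≢z j c) ⟩
    j * ([ c ≟ c ] + [ c ≟ z ]) + degree (base ρ) c + r    ≡⟨ cong₂ (λ p q → j * (p + q) + degree (base ρ) c + r)
                                                                     ([v≟v]≡1 c) [c≟z]≡0 ⟩
    j * 1 + degree (base ρ) c + r                          ≡⟨ +-assoc (j * 1) _ r ⟩
    j * 1 + (degree (base ρ) c + r)                        ≡⟨ cong₂ _+_ (*-identityʳ j) (trans (degree-base-c ρ) (real c′)) ⟩
    j + d′ c′                                              ≡⟨ +-comm j (d′ c′) ⟩
    d′ c′ + j                                              ≡⟨ dc ⟨
    d c + r                                                ∎)
    where open ≡-Reasoning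
  ... | elsewhere i i≢c′ = begin
    degree (addEdges (base ρ) c≢z j) x               ≡⟨ degree-addEdges (base ρ) c≢z j x ⟩
    j * ([ x ≟ c ] + [ x ≟ z ]) + degree (base ρ) x  ≡⟨ cong₂ (λ p q → j * (p + q) + degree (base ρ) x)
                                                          ([v≟w]≡0 (i≢c′ ∘ punchIn-injective z i c′)) ([v≟w]≡0 (punchInᵢ≢i z i)) ⟩
    j * 0 + degree (base ρ) x                        ≡⟨ cong₂ _+_ (*-zeroʳ j) (degree-base-elsewhere ρ i≢c′) ⟩
    degree G i                                       ≡⟨ real i ⟩
    d′ i                                             ≡⟨ d-elsewhere i i≢c′ ⟨
    d x                                              ∎
    where open ≡-Reasoning

record Bispanning (k : ℕ) {n} (d : Fin n → ℕ) : Set where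
  field
    graph      : Multigraph n
    realizes   : Realizes graph d
    S₁ S₂      : Subset (m graph)
    connected₁ : Connected graph S₁
    connected₂ : Connected graph S₂
    shared     : ∣ S₁ ∩ S₂ ∣ ≤ k

no-vertices : ∀ {k} {d : Fin 0 → ℕ} → Bispanning k d
no-vertices = record
  { graph      = record { m = 0 ; ends = λ () ; loopless = λ () }
  ; realizes   = λ ()
  ; S₁         = []
  ; S₂         = []
  ; connected₁ = λ ()
  ; connected₂ = λ ()
  ; shared     = z≤n
  }

single-vertex : ∀ {k} {d : Fin 1 → ℕ} → d zero ≡ 0 → Bispanning k d
single-vertex d₀≡0 = record
  { graph      = record { m = 0 ; ends = λ () ; loopless = λ () }
  ; realizes   = λ { zero → sym d₀≡0 }
  ; S₁         = []
  ; S₂         = []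
  ; connected₁ = λ { zero zero → here }
  ; connected₂ = λ { zero zero → here }
  ; shared     = z≤n
  }

weaken : ∀ {k k′ n} {d : Fin n → ℕ} → k ≤ k′ → Bispanning k d → Bispanning k′ d
weaken k≤k′ B = record
  { graph      = graph
  ; realizes   = realizes
  ; S₁         = S₁
  ; S₂         = S₂
  ; connected₁ = connected₁
  ; connected₂ = connected₂
  ; shared     = ≤-trans shared k≤k′
  }
  where open Bispanning B

bispanning-addEdge : ∀ {k n} {d′ d : Fin n → ℕ} → Bispanning k d′ → ∀ {u w} (u≢w : u ≢ w) →
                     (∀ v → d v ≡ [ v ≟ u ] + [ v ≟ w ] + d′ v) → Bispanning k d
bispanning-addEdge B {u} {w} u≢w d≡ = record
  { graph      = addEdge graph u w u≢w
  ; realizes   = λ v → trans (degree-addEdge graph u≢w v) (trans (cong (_ +_) (realizes v)) (sym (d≡ v)))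
  ; S₁         = false ∷ S₁
  ; S₂         = false ∷ S₂
  ; connected₁ = λ x y → Reach-addEdge graph u≢w (connected₁ x y)
  ; connected₂ = λ x y → Reach-addEdge graph u≢w (connected₂ x y)
  ; shared     = shared
  }
  where open Bispanning B

module _ {k n} {d′ : Fin n → ℕ} {d : Fin (suc n) → ℕ} (B : Bispanning k d′) (z : Fin (suc n)) (c′ : Fin n)
         {r} (r≤1 : r ≤ 1) (r≤d′c′ : r ≤ d′ c′) where

  open Bispanning B
  open Pendant graph z c′

  private
    ρ : Redirection graph c′ r
    ρ = redirection graph r r≤1 (subst (r ≤_) (sym (realizes c′)) r≤d′c′)

  attach₂ : d z ≡ 2 + r → d c + r ≡ d′ c′ + 2 → (∀ i → i ≢ c′ → d (punchIn z i) ≡ d′ i) → Bispanning k d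
  attach₂ dz dc d-elsewhere = record
    { graph      = F
    ; realizes   = realizes-attached ρ 2 realizes dz dc d-elsewhere
    ; S₁         = true ∷ false ∷ S₁
    ; S₂         = false ∷ true ∷ S₂
    ; connected₁ = connected-pullback Glued glued-total (glued-fibres (edge-reach F {e = zero} here))
                     (λ {e′} e′∈ → suc (suc e′) , there (there e′∈) , glued-ends ρ e′) connected₁
    ; connected₂ = connected-pullback Glued glued-total (glued-fibres (edge-reach F {e = suc zero} (there here)))
                     (λ {e′} e′∈ → suc (suc e′) , there (there e′∈) , glued-ends ρ e′) connected₂
    ; shared     = shared
    }
    where F = addEdges (base ρ) c≢z 2

  attach₁ : d z ≡ 1 + r → d c + r ≡ d′ c′ + 1 → (∀ i → i ≢ c′ → d (punchIn z i) ≡ d′ i) → Bispanning (suc k) d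
  attach₁ dz dc d-elsewhere = record
    { graph      = F
    ; realizes   = realizes-attached ρ 1 realizes dz dc d-elsewhere
    ; S₁         = true ∷ S₁
    ; S₂         = true ∷ S₂
    ; connected₁ = connected-pullback Glued glued-total (glued-fibres (edge-reach F {e = zero} here))
                     (λ {e′} e′∈ → suc e′ , there e′∈ , glued-ends ρ e′) connected₁
    ; connected₂ = connected-pullback Glued glued-total (glued-fibres (edge-reach F {e = zero} here))
                     (λ {e′} e′∈ → suc e′ , there e′∈ , glued-ends ρ e′) connected₂
    ; shared     = s≤s shared
    }
    where F = addEdges (base ρ) c≢z 1

shrink : ∀ {n} (d : Fin (suc n) → ℕ) (z : Fin (suc n)) (c′ : Fin n) (δ : ℕ) → Fin n → ℕ
shrink d z c′ δ = updateAt (removeAt d z) c′ (_∸ δ)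

module _ {n} (d : Fin (suc n) → ℕ) (z : Fin (suc n)) (c′ : Fin n) (δ : ℕ) where

  shrink-c : shrink d z c′ δ c′ ≡ d (punchIn z c′) ∸ δ
  shrink-c = updateAt-updates c′ (removeAt d z)

  shrink-elsewhere : ∀ {i} → i ≢ c′ → shrink d z c′ δ i ≡ d (punchIn z i)
  shrink-elsewhere {i} i≢c′ = updateAt-minimal i c′ (removeAt d z) i≢c′

  shrink-cases : (P : ℕ → Set) → P (d (punchIn z c′) ∸ δ) → (∀ {i} → i ≢ c′ → P (d (punchIn z i))) →
                 ∀ i → P (shrink d z c′ δ i)
  shrink-cases P at-c′ away i with i ≟ c′
  ... | yes refl = subst P (sym shrink-c) at-c′
  ... | no i≢c′  = subst P (sym (shrink-elsewhere i≢c′)) (away i≢c′)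

  shrink-≤ : ∀ {U} → d (punchIn z c′) ∸ δ ≤ U → (∀ {i} → i ≢ c′ → d (punchIn z i) ≤ U) → ∀ i → shrink d z c′ δ i ≤ U
  shrink-≤ {U} = shrink-cases (_≤ U)

  shrink-≥ : ∀ {L} → L ≤ d (punchIn z c′) ∸ δ → (∀ {i} → i ≢ c′ → L ≤ d (punchIn z i)) → ∀ i → L ≤ shrink d z c′ δ i
  shrink-≥ {L} = shrink-cases (L ≤_)

  ∑-shrink : δ ≤ d (punchIn z c′) → ∑ d ≡ d z + (∑ (shrink d z c′ δ) + δ)
  ∑-shrink δ≤dc = begin
    ∑ d                                  ≡⟨ sum-remove d ⟩
    d z + ∑ (removeAt d z)               ≡⟨ cong (d z +_) (+-identityʳ _) ⟨
    d z + (∑ (removeAt d z) + 0)         ≡⟨ cong (d z +_) (∑-agree-except c′ (λ i i≢c′ → shrink-elsewhere i≢c′) at-c′) ⟨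
    d z + (∑ (shrink d z c′ δ) + δ)      ∎
    where
    open ≡-Reasoning
    at-c′ : shrink d z c′ δ c′ + δ ≡ d (punchIn z c′) + 0
    at-c′ = trans (cong (_+ δ) shrink-c) (trans (m∸n+n≡m δ≤dc) (sym (+-identityʳ _)))

attach₂-shrink : ∀ {k n} {d : Fin (suc n) → ℕ} z c′ r → r ≤ 1 → d z ≡ 2 + r → 2 ≤ d (punchIn z c′) →
                 Bispanning k (shrink d z c′ (2 ∸ r)) → Bispanning k d
attach₂-shrink {d = d} z c′ 0 z≤n dz 2≤dc B =
  attach₂ B z c′ z≤n z≤n dz
    (trans (+-identityʳ _) (sym (trans (cong (_+ 2) (shrink-c d z c′ 2)) (m∸n+n≡m 2≤dc))))
    (λ i i≢c′ → sym (shrink-elsewhere d z c′ 2 i≢c′))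
attach₂-shrink {d = d} z c′ 1 (s≤s z≤n) dz 2≤dc B =
  attach₂ B z c′ ≤-refl (subst (1 ≤_) (sym (shrink-c d z c′ 1)) (∸-monoˡ-≤ 1 2≤dc)) dz
    (sym (trans (cong (_+ 2) (shrink-c d z c′ 1)) (trans (sym (+-assoc (d (punchIn z c′) ∸ 1) 1 1))
      (cong (_+ 1) (m∸n+n≡m (≤-trans (n≤1+n 1) 2≤dc))))))
    (λ i i≢c′ → sym (shrink-elsewhere d z c′ 1 i≢c′))

attach₁-shrink : ∀ {k n} {d : Fin (suc n) → ℕ} z c′ r → r ≤ 1 → d z ≡ 1 + r → 1 ≤ d (punchIn z c′) →
                 Bispanning k (shrink d z c′ (1 ∸ r)) → Bispanning (suc k) d
attach₁-shrink {d = d} z c′ 0 z≤n dz 1≤dc B =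
  attach₁ B z c′ z≤n z≤n dz
    (trans (+-identityʳ _) (sym (trans (cong (_+ 1) (shrink-c d z c′ 1)) (m∸n+n≡m 1≤dc))))
    (λ i i≢c′ → sym (shrink-elsewhere d z c′ 1 i≢c′))
attach₁-shrink {d = d} z c′ 1 (s≤s z≤n) dz 1≤dc B =
  attach₁ B z c′ ≤-refl (subst (1 ≤_) (sym (shrink-c d z c′ 0)) 1≤dc) dz
    (cong (_+ 1) (sym (shrink-c d z c′ 0)))
    (λ i i≢c′ → sym (shrink-elsewhere d z c′ 0 i≢c′))

witness⇒≤ : ∀ {a b} j → a + j ≡ b → a ≤ b
witness⇒≤ {a} j refl = m≤m+n a j

2[2+n]≡2+2[1+n] : ∀ n → 2 * suc (suc n) ≡ suc (suc (suc n * 2))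
2[2+n]≡2+2[1+n] = solve-∀

2[1+n]≡2n+2 : ∀ n → 2 * suc n ≡ 2 * n + 2
2[1+n]≡2n+2 = solve-∀

2[2+n]≡2n+1+3 : ∀ n → 2 * suc (suc n) ≡ suc (2 * n) + 3
2[2+n]≡2n+1+3 = solve-∀

4[1+n]≡4+4n : ∀ n → 2 * (2 * suc n) ≡ 4 + 2 * (2 * n)
4[1+n]≡4+4n = solve-∀

2[3+2n]≡4+2[1+2n] : ∀ n → 2 * suc (2 * suc n) ≡ 4 + 2 * suc (2 * n)
2[3+2n]≡4+2[1+2n] = solve-∀

≰∧≤suc⇒≡suc : ∀ {a b} → a ≰ b → a ≤ suc b → a ≡ suc b
≰∧≤suc⇒≡suc a≰b a≤1+b = ≤-antisym a≤1+b (≰⇒> a≰b)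

degree-search : ∀ {n} (d : Fin n → ℕ) k → (∃[ v ] d v ≡ k) ⊎ (∀ v → d v ≢ k)
degree-search d k with any? (λ v → d v ≟ℕ k)
... | yes found = inj₁ found
... | no none   = inj₂ (λ v dv≡k → none (v , dv≡k))

heavy-everywhere : ∀ {n} {d : Fin n → ℕ} → (∀ v → 2 ≤ d v) → (∀ v → d v ≢ 2) → (∀ v → d v ≢ 3) → ∀ v → 4 ≤ d v
heavy-everywhere 2≤ no-two no-three v = ≤∧≢⇒< (≤∧≢⇒< (2≤ v) (no-two v ∘ sym)) (no-three v ∘ sym)

isolated-vertex : ∀ {d : Fin 1 → ℕ} {m} → ∑ d ≡ 2 * m → d zero ≤ m → d zero ≡ 0
isolated-vertex {d} {m} sum≡2m d₀≤m = n≤0⇒n≡0 (≤-trans d₀≤m (≤-reflexive m≡0))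
  where
  m+m≤m+0 : m + m ≤ m + 0
  m+m≤m+0 = begin
    m + m              ≡⟨ cong (m +_) (+-identityʳ m) ⟨
    2 * m              ≡⟨ sum≡2m ⟨
    d zero + 0         ≤⟨ +-monoˡ-≤ 0 d₀≤m ⟩
    m + 0              ∎
    where open ≤-Reasoning
  m≡0 : m ≡ 0
  m≡0 = n≤0⇒n≡0 (+-cancelˡ-≤ m _ _ m+m≤m+0)

-- At least 2n − 2 edges: edge-disjoint spanning sets

record DisjointCondition {n} (d : Fin n → ℕ) (m : ℕ) : Set where
  field
    sum≡2m : ∑ d ≡ 2 * m
    ≤m     : ∀ v → d v ≤ m
    2≤     : ∀ v → 2 ≤ d v
    enough : 2 * n ≤ m + 2

module _ {n m} {d : Fin (suc (suc n)) → ℕ} (cond : DisjointCondition d (suc m))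
         (slack : 2 * suc (suc n) ≤ suc m + 1) where

  open DisjointCondition cond

  private
    u : Fin (suc (suc n))
    u = proj₁ (heaviest d)

    max-u : ∀ v → d v ≤ d u
    max-u = proj₂ (heaviest d)

    w : Fin (suc (suc n))
    w = punchIn u (proj₁ (heaviest-except d u))

    u≢w : u ≢ w
    u≢w = punchInᵢ≢i u _ ∘ sym

    max-w : ∀ v → v ≢ u → d v ≤ d w
    max-w = proj₂ (heaviest-except d u)

    3≤dw : 3 ≤ d w
    3≤dw with 3 ≤? d w
    ... | yes 3≤ = 3≤
    ... | no 3≰  = ⊥-elim (<-irrefl refl (begin-strict
      2 * suc m                ≡⟨ sum≡2m ⟨
      ∑ d                      ≤⟨ ∑-≤-at d u (λ v v≢u → ≤-trans (max-w v v≢u) (≤-pred (≰⇒> 3≰))) ⟩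
      d u + suc n * 2          ≤⟨ +-monoˡ-≤ _ (≤m u) ⟩
      suc m + suc n * 2        <⟨ +-monoʳ-< (suc m) (s≤s⁻¹ (subst₂ _≤_ (2[2+n]≡2+2[1+n] n) (+-comm (suc m) 1) slack)) ⟩
      suc m + suc m            ≡⟨ cong (suc m +_) (+-identityʳ (suc m)) ⟨
      2 * suc m                ∎))
      where open ≤-Reasoning

    drop : Fin (suc (suc n)) → ℕ
    drop v = [ v ≟ u ] + [ v ≟ w ]

    drop≡1 : ∀ {v} → v ≡ u ⊎ v ≡ w → drop v ≡ 1
    drop≡1 (inj₁ refl) = cong₂ _+_ ([v≟v]≡1 u) ([v≟w]≡0 u≢w)
    drop≡1 (inj₂ refl) = cong₂ _+_ ([v≟w]≡0 (u≢w ∘ sym)) ([v≟v]≡1 w)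

    drop≡0 : ∀ {v} → v ≢ u → v ≢ w → drop v ≡ 0
    drop≡0 v≢u v≢w = cong₂ _+_ ([v≟w]≡0 v≢u) ([v≟w]≡0 v≢w)

    at-ends : ∀ {v} → v ≡ u ⊎ v ≡ w → 3 ≤ d v
    at-ends (inj₁ refl) = ≤-trans 3≤dw (max-u w)
    at-ends (inj₂ refl) = 3≤dw

    d′ : Fin (suc (suc n)) → ℕ
    d′ v = d v ∸ drop v

    endpoint? : ∀ v → (v ≡ u ⊎ v ≡ w) ⊎ (v ≢ u × v ≢ w)
    endpoint? v with v ≟ u | v ≟ w
    ... | yes v≡u | _       = inj₁ (inj₁ v≡u)
    ... | no _    | yes v≡w = inj₁ (inj₂ v≡w)
    ... | no v≢u  | no v≢w  = inj₂ (v≢u , v≢w)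

    drop≤d : ∀ v → drop v ≤ d v
    drop≤d v with endpoint? v
    ... | inj₁ end            = ≤-trans (≤-reflexive (drop≡1 end)) (≤-trans (n≤1+n 1) (2≤ v))
    ... | inj₂ (v≢u , v≢w)    = ≤-trans (≤-reflexive (drop≡0 v≢u v≢w)) z≤n

    lowered : ∀ v → d v ≡ [ v ≟ u ] + [ v ≟ w ] + d′ v
    lowered v = sym (m+[n∸m]≡n (drop≤d v))

    ∑d≡2+∑d′ : ∑ d ≡ 2 + ∑ d′
    ∑d≡2+∑d′ = begin
      ∑ d                                                  ≡⟨ sum-cong-≗ lowered ⟩
      ∑ (λ v → drop v + d′ v)                              ≡⟨ ∑-distrib-+ drop d′ ⟩
      ∑ drop + ∑ d′                                        ≡⟨ cong (_+ ∑ d′) (∑-distrib-+ (λ v → [ v ≟ u ]) (λ v → [ v ≟ w ])) ⟩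
      ∑ (λ v → [ v ≟ u ]) + ∑ (λ v → [ v ≟ w ]) + ∑ d′     ≡⟨ cong₂ (λ p q → p + q + ∑ d′) (∑[v≟a]≡1 u) (∑[v≟a]≡1 w) ⟩
      2 + ∑ d′                                             ∎
      where open ≡-Reasoning

    interior≤m : ∀ {v} → v ≢ u → v ≢ w → d v ≤ m
    interior≤m {v} v≢u v≢w with d v ≤? m
    ... | yes dv≤m = dv≤m
    ... | no dv≰m  = ⊥-elim (<⇒≱ (begin-strict
      2 * suc m                   ≡⟨ cong (suc m +_) (+-identityʳ (suc m)) ⟩
      suc m + suc m               <⟨ m<m+n (suc m + suc m) (s≤s z≤n) ⟩
      suc m + suc m + suc m       ≤⟨ +-mono-≤ (+-mono-≤ (≤-trans dv≥ (max-u v)) (≤-trans dv≥ (max-w v v≢u))) dv≥ ⟩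
      d u + d w + d v             ≤⟨ three-terms≤∑ d u≢w (v≢u ∘ sym) (v≢w ∘ sym) ⟩
      ∑ d                         ≡⟨ sum≡2m ⟩
      2 * suc m                   ∎) ≤-refl)
      where
      open ≤-Reasoning
      dv≥ : suc m ≤ d v
      dv≥ = ≰⇒> dv≰m

    condition : DisjointCondition d′ m
    condition = record
      { sum≡2m = +-cancelˡ-≡ 2 _ _ (trans (sym ∑d≡2+∑d′) (trans sum≡2m (*-suc 2 m)))
      ; ≤m     = d′≤m
      ; 2≤     = 2≤d′
      ; enough = ≤-trans slack (≤-reflexive (sym (+-suc m 1)))
      }
      where
      d′≤m : ∀ v → d′ v ≤ m
      d′≤m v with endpoint? v
      ... | inj₁ end         = subst (λ x → d v ∸ x ≤ m) (sym (drop≡1 end)) (∸-monoˡ-≤ 1 (≤m v))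
      ... | inj₂ (v≢u , v≢w) = subst (λ x → d v ∸ x ≤ m) (sym (drop≡0 v≢u v≢w)) (interior≤m v≢u v≢w)
      2≤d′ : ∀ v → 2 ≤ d′ v
      2≤d′ v with endpoint? v
      ... | inj₁ end         = subst (λ x → 2 ≤ d v ∸ x) (sym (drop≡1 end)) (∸-monoˡ-≤ 1 (at-ends end))
      ... | inj₂ (v≢u , v≢w) = subst (λ x → 2 ≤ d v ∸ x) (sym (drop≡0 v≢u v≢w)) (2≤ v)

  disjoint-by-edge : ∀ {k} → (∀ {d′ : Fin (suc (suc n)) → ℕ} → DisjointCondition d′ m → Bispanning k d′) → Bispanning k d
  disjoint-by-edge ih = bispanning-addEdge (ih condition) u≢w lowered

module _ {k} {d : Fin (suc (suc (suc k))) → ℕ} (cond : DisjointCondition d (2 * suc (suc k)))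
         {z} (dz≡3 : d z ≡ 3) {c′} (heaviest : ∀ v → v ≢ z → d v ≤ d (punchIn z c′)) where

  open DisjointCondition cond

  private
    c : Fin (suc (suc (suc k)))
    c = punchIn z c′

    z≢c : z ≢ c
    z≢c = punchInᵢ≢i z c′ ∘ sym

    3≤dc : 3 ≤ d c
    3≤dc with 3 ≤? d c
    ... | yes 3≤ = 3≤
    ... | no 3≰  = ⊥-elim (<⇒≱ 3+2K<4K (begin
      2 * (2 * suc (suc k))     ≡⟨ sum≡2m ⟨
      ∑ d                       ≤⟨ ∑-≤-at d z (λ v v≢z → ≤-trans (heaviest v v≢z) (≤-pred (≰⇒> 3≰))) ⟩
      d z + suc (suc k) * 2     ≡⟨ cong (_+ suc (suc k) * 2) dz≡3 ⟩
      3 + suc (suc k) * 2       ∎))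
      where
      open ≤-Reasoning
      3+2K<4K : 3 + suc (suc k) * 2 < 2 * (2 * suc (suc k))
      3+2K<4K = witness⇒≤ (2 * k) (gap k)
        where
        gap : ∀ k → suc (3 + suc (suc k) * 2) + 2 * k ≡ 2 * (2 * suc (suc k))
        gap = solve-∀

    dc≤ : d c ≤ suc (2 * suc k)
    dc≤ = +-cancelˡ-≤ (3 + suc k * 2) _ _ (subst₂ _≤_ (reorder k (d c)) (split k) (begin
      3 + d c + suc k * 2       ≡⟨ cong (λ x → x + d c + suc k * 2) dz≡3 ⟨
      d z + d c + suc k * 2     ≤⟨ ∑-≥-at₂ d z≢c 2≤ ⟩
      ∑ d                       ≡⟨ sum≡2m ⟩
      2 * (2 * suc (suc k))     ∎))
      where
      open ≤-Reasoning
      reorder : ∀ k x → 3 + x + suc k * 2 ≡ 3 + suc k * 2 + x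
      reorder = solve-∀
      split : ∀ k → 2 * (2 * suc (suc k)) ≡ 3 + suc k * 2 + suc (2 * suc k)
      split = solve-∀

    interior≤ : ∀ {i} → i ≢ c′ → d (punchIn z i) ≤ 2 * suc k
    interior≤ {i} i≢c′ with d v ≤? 2 * suc k
      where v = punchIn z i
    ... | yes dv≤ = dv≤
    ... | no dv≰  = ⊥-elim (<-irrefl refl (begin-strict
      2 * (2 * suc (suc k))                        <⟨ witness⇒≤ 0 (gap k) ⟩
      3 + suc (2 * suc k) + suc (2 * suc k)         ≤⟨ +-mono-≤ (+-monoʳ-≤ 3 (≤-trans dv≥ (heaviest v (punchInᵢ≢i z i)))) dv≥ ⟩
      3 + d c + d v                                 ≡⟨ cong (λ x → x + d c + d v) dz≡3 ⟨
      d z + d c + d v                               ≤⟨ three-terms≤∑ d z≢c (punchInᵢ≢i z i ∘ sym)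
                                                                     (i≢c′ ∘ sym ∘ punchIn-injective z c′ i) ⟩
      ∑ d                                           ≡⟨ sum≡2m ⟩
      2 * (2 * suc (suc k))                         ∎))
      where
      open ≤-Reasoning
      v = punchIn z i
      dv≥ : suc (2 * suc k) ≤ d v
      dv≥ = ≰⇒> dv≰
      gap : ∀ k → suc (2 * (2 * suc (suc k))) + 0 ≡ 3 + suc (2 * suc k) + suc (2 * suc k)
      gap = solve-∀

    d′ : Fin (suc (suc k)) → ℕ
    d′ = shrink d z c′ 1

    condition : DisjointCondition d′ (2 * suc k)
    condition = record
      { sum≡2m = +-cancelˡ-≡ 4 _ _ (begin
          4 + ∑ d′                    ≡⟨ 4+x≡3+[x+1] (∑ d′) ⟩
          3 + (∑ d′ + 1)              ≡⟨ cong (_+ (∑ d′ + 1)) dz≡3 ⟨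
          d z + (∑ d′ + 1)            ≡⟨ ∑-shrink d z c′ 1 (≤-trans (s≤s z≤n) 3≤dc) ⟨
          ∑ d                         ≡⟨ sum≡2m ⟩
          2 * (2 * suc (suc k))       ≡⟨ 4[1+n]≡4+4n (suc k) ⟩
          4 + 2 * (2 * suc k)         ∎)
      ; ≤m     = shrink-≤ d z c′ 1 (∸-monoˡ-≤ 1 dc≤) interior≤
      ; 2≤     = shrink-≥ d z c′ 1 (∸-monoˡ-≤ 1 3≤dc) (λ _ → 2≤ _)
      ; enough = ≤-reflexive (2[1+n]≡2n+2 (suc k))
      }
      where
      open ≡-Reasoning
      4+x≡3+[x+1] : ∀ x → 4 + x ≡ 3 + (x + 1)
      4+x≡3+[x+1] = solve-∀

  disjoint-by-degree-three : (∀ {d′ : Fin (suc (suc k)) → ℕ} → DisjointCondition d′ (2 * suc k) → Bispanning 0 d′) →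
                        Bispanning 0 d
  disjoint-by-degree-three ih = attach₂-shrink z c′ 1 (s≤s z≤n) dz≡3 (≤-trans (n≤1+n 2) 3≤dc) (ih condition)

module _ {k} {d : Fin (suc (suc (suc k))) → ℕ} (cond : DisjointCondition d (2 * suc (suc k)))
         (no-three : ∀ v → d v ≢ 3) {z} (dz≡2 : d z ≡ 2) {c′} (heaviest : ∀ v → v ≢ z → d v ≤ d (punchIn z c′)) where

  open DisjointCondition cond

  private
    c : Fin (suc (suc (suc k)))
    c = punchIn z c′

    4≤dc : 4 ≤ d c
    4≤dc with 3 ≤? d c
    ... | yes 3≤ = ≤∧≢⇒< 3≤ (no-three c ∘ sym)
    ... | no 3≰  = ⊥-elim (<⇒≱ 2+2K<4K (begin
      2 * (2 * suc (suc k))     ≡⟨ sum≡2m ⟨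
      ∑ d                       ≤⟨ ∑-≤-at d z (λ v v≢z → ≤-trans (heaviest v v≢z) (≤-pred (≰⇒> 3≰))) ⟩
      d z + suc (suc k) * 2     ≡⟨ cong (_+ suc (suc k) * 2) dz≡2 ⟩
      2 + suc (suc k) * 2       ∎))
      where
      open ≤-Reasoning
      2+2K<4K : 2 + suc (suc k) * 2 < 2 * (2 * suc (suc k))
      2+2K<4K = witness⇒≤ (suc (2 * k)) (gap k)
        where
        gap : ∀ k → suc (2 + suc (suc k) * 2) + suc (2 * k) ≡ 2 * (2 * suc (suc k))
        gap = solve-∀

    interior≤ : ∀ {i} → i ≢ c′ → d (punchIn z i) ≤ 2 * suc k
    interior≤ {i} i≢c′ = +-cancelˡ-≤ (4 + suc k * 2) _ _ (subst₂ _≤_ (reorder k (d v)) (split k) (begin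
      4 + d v + suc k * 2       ≤⟨ +-monoˡ-≤ (suc k * 2) (+-monoˡ-≤ (d v) 4≤dc) ⟩
      d c + d v + suc k * 2     ≤⟨ ∑-≥-at₂ d (i≢c′ ∘ sym ∘ punchIn-injective z c′ i) 2≤ ⟩
      ∑ d                       ≡⟨ sum≡2m ⟩
      2 * (2 * suc (suc k))     ∎))
      where
      open ≤-Reasoning
      v = punchIn z i
      reorder : ∀ k x → 4 + x + suc k * 2 ≡ 4 + suc k * 2 + x
      reorder = solve-∀
      split : ∀ k → 2 * (2 * suc (suc k)) ≡ 4 + suc k * 2 + 2 * suc k
      split = solve-∀

    d′ : Fin (suc (suc k)) → ℕ
    d′ = shrink d z c′ 2

    condition : DisjointCondition d′ (2 * suc k)
    condition = record
      { sum≡2m = +-cancelˡ-≡ 4 _ _ 4+∑d′≡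
      ; ≤m     = shrink-≤ d z c′ 2 dc-2≤ interior≤
      ; 2≤     = shrink-≥ d z c′ 2 (∸-monoˡ-≤ 2 4≤dc) (λ _ → 2≤ _)
      ; enough = ≤-reflexive (2[1+n]≡2n+2 (suc k))
      }
      where
      4+∑d′≡ : 4 + ∑ d′ ≡ 4 + 2 * (2 * suc k)
      4+∑d′≡ = begin
          4 + ∑ d′                    ≡⟨ +-comm 4 (∑ d′) ⟩
          ∑ d′ + 4                    ≡⟨ +-assoc (∑ d′) 2 2 ⟨
          ∑ d′ + 2 + 2                ≡⟨ +-comm (∑ d′ + 2) 2 ⟩
          2 + (∑ d′ + 2)              ≡⟨ cong (_+ (∑ d′ + 2)) dz≡2 ⟨
          d z + (∑ d′ + 2)            ≡⟨ ∑-shrink d z c′ 2 (≤-trans (n≤1+n 2) (≤-trans (n≤1+n 3) 4≤dc)) ⟨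
          ∑ d                         ≡⟨ sum≡2m ⟩
          2 * (2 * suc (suc k))       ≡⟨ 4[1+n]≡4+4n (suc k) ⟩
          4 + 2 * (2 * suc k)         ∎
        where open ≡-Reasoning
      dc-2≤ : d c ∸ 2 ≤ 2 * suc k
      dc-2≤ = begin
        d c ∸ 2                     ≤⟨ ∸-monoˡ-≤ 2 (≤m c) ⟩
        2 * suc (suc k) ∸ 2         ≡⟨ cong (_∸ 2) (2[1+n]≡2n+2 (suc k)) ⟩
        2 * suc k + 2 ∸ 2           ≡⟨ m+n∸n≡m (2 * suc k) 2 ⟩
        2 * suc k                   ∎
        where open ≤-Reasoning

  disjoint-by-degree-two : (∀ {d′ : Fin (suc (suc k)) → ℕ} → DisjointCondition d′ (2 * suc k) → Bispanning 0 d′) →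
                      Bispanning 0 d
  disjoint-by-degree-two ih = attach₂-shrink z c′ 0 z≤n dz≡2 (≤-trans (n≤1+n 2) (≤-trans (n≤1+n 3) 4≤dc)) (ih condition)

two-vertices : ∀ {d : Fin 2 → ℕ} → DisjointCondition d 2 → ∀ {z} → d z ≡ 2 → Bispanning 0 d
two-vertices {d} cond {z} dz≡2 =
  attach₂-shrink z zero 0 z≤n dz≡2 (≤-reflexive (sym dc≡2))
    (single-vertex (trans (shrink-c d z zero 2) (cong (_∸ 2) dc≡2)))
  where
  open DisjointCondition cond
  dc≡2 : d (punchIn z zero) ≡ 2
  dc≡2 = +-cancelˡ-≡ 2 _ _ (begin
    2 + d (punchIn z zero)           ≡⟨ cong (_+ d (punchIn z zero)) dz≡2 ⟨
    d z + d (punchIn z zero)         ≡⟨ cong (d z +_) (+-identityʳ _) ⟨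
    d z + (d (punchIn z zero) + 0)   ≡⟨ sum-remove d ⟨
    ∑ d                              ≡⟨ sum≡2m ⟩
    2 + 2                            ∎)
    where open ≡-Reasoning

tight-disjoint : ∀ {n} {d : Fin (suc (suc n)) → ℕ} → DisjointCondition d (2 * suc n) →
                 (∀ {m′} → m′ < 2 * suc n → ∀ {n′} {d′ : Fin n′ → ℕ} → DisjointCondition d′ m′ → Bispanning 0 d′) →
                 Bispanning 0 d
tight-disjoint {n} {d} cond ih with degree-search d 3 | degree-search d 2
tight-disjoint {zero}  cond ih | inj₁ (z , dz≡3) | _ =
  ⊥-elim (<⇒≱ ≤-refl (≤-trans (≤-reflexive (sym dz≡3)) (DisjointCondition.≤m cond z)))
tight-disjoint {suc k} {d} cond ih | inj₁ (z , dz≡3) | _ =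
  disjoint-by-degree-three cond dz≡3 (proj₂ (heaviest-except d z)) (ih (*-monoʳ-< 2 (n<1+n (suc k))))
tight-disjoint {zero}  cond ih | inj₂ no-three | inj₁ (z , dz≡2) = two-vertices cond dz≡2
tight-disjoint {suc k} {d} cond ih | inj₂ no-three | inj₁ (z , dz≡2) =
  disjoint-by-degree-two cond no-three dz≡2 (proj₂ (heaviest-except d z)) (ih (*-monoʳ-< 2 (n<1+n (suc k))))
... | inj₂ no-three | inj₂ no-two = ⊥-elim (<⇒≱ (witness⇒≤ 3 (gap n)) (begin
  suc (suc n) * 4     ≤⟨ ∑-≥-const d (heavy-everywhere 2≤ no-two no-three) ⟩
  ∑ d                 ≡⟨ sum≡2m ⟩
  2 * (2 * suc n)     ∎))
  where
  open DisjointCondition cond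
  open ≤-Reasoning
  gap : ∀ n → suc (2 * (2 * suc n)) + 3 ≡ suc (suc n) * 4
  gap = solve-∀

disjoint-bispanning : ∀ m {n} {d : Fin n → ℕ} → DisjointCondition d m → Bispanning 0 d
disjoint-bispanning = <-rec P step
  where
  P : ℕ → Set
  P m = ∀ {n} {d : Fin n → ℕ} → DisjointCondition d m → Bispanning 0 d
  step : ∀ m → (∀ {m′} → m′ < m → P m′) → P m
  step m ih {zero}  cond = no-vertices
  step m ih {suc zero} {d} cond = ⊥-elim (<⇒≱ (s≤s z≤n) (≤-trans (2≤ zero) (≤-reflexive (isolated-vertex {d} sum≡2m (≤m zero)))))
    where open DisjointCondition cond
  step m ih {suc (suc n)} {d} cond with 2 * suc (suc n) ≤? m + 1
  step (suc m) ih {suc (suc n)} cond | yes slack = disjoint-by-edge cond slack (ih ≤-refl)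
  step zero    ih {suc (suc n)} cond | yes (s≤s ())
  ... | no tight = tight-disjoint (subst (DisjointCondition d) m≡2[n+1] cond)
                                  (λ m′<2[n+1] → ih (subst (_ <_) (sym m≡2[n+1]) m′<2[n+1]))
    where
    m≡2[n+1] : m ≡ 2 * suc n
    m≡2[n+1] = +-cancelʳ-≡ 2 _ _ (begin
      m + 2                  ≡⟨ +-suc m 1 ⟩
      suc (m + 1)            ≡⟨ ≰∧≤suc⇒≡suc tight (≤-trans (DisjointCondition.enough cond) (≤-reflexive (+-suc m 1))) ⟨
      2 * suc (suc n)        ≡⟨ 2[1+n]≡2n+2 (suc n) ⟩
      2 * suc n + 2          ∎)
      where
      open ≡-Reasoning

-- At least 2n − 3 edges: one shared edge

record SharedCondition {n} (d : Fin n → ℕ) (m : ℕ) : Set where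
  field
    sum≡2m   : ∑ d ≡ 2 * m
    ≤m       : ∀ v → d v ≤ m
    1≤       : ∀ v → 1 ≤ d v
    one-leaf : 2 < n → ∀ u v → d u ≡ 1 → d v ≡ 1 → u ≡ v
    enough   : 2 * n ≤ m + 3

two-leaves : ∀ {d : Fin 2 → ℕ} {m} → SharedCondition d m → ∀ {z} → d z ≡ 1 → Bispanning 1 d
two-leaves {d} {m} cond {z} dz≡1 =
  attach₁-shrink z zero 0 z≤n dz≡1 (1≤ c) (single-vertex (trans (shrink-c d z zero 1) (cong (_∸ 1) dc≡1)))
  where
  open SharedCondition cond
  c = punchIn z zero
  1+dc≡2m : 1 + d c ≡ 2 * m
  1+dc≡2m = begin
    1 + d c             ≡⟨ cong (_+ d c) dz≡1 ⟨
    d z + d c           ≡⟨ cong (d z +_) (+-identityʳ _) ⟨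
    d z + (d c + 0)     ≡⟨ sum-remove d ⟨
    ∑ d                 ≡⟨ sum≡2m ⟩
    2 * m               ∎
    where open ≡-Reasoning
  m≤1 : m ≤ 1
  m≤1 = +-cancelˡ-≤ m _ _ (begin
    m + m               ≡⟨ cong (m +_) (+-identityʳ m) ⟨
    2 * m               ≡⟨ 1+dc≡2m ⟨
    1 + d c             ≤⟨ +-monoʳ-≤ 1 (≤m c) ⟩
    1 + m               ≡⟨ +-comm 1 m ⟩
    m + 1               ∎)
    where open ≤-Reasoning
  m≡1 : m ≡ 1
  m≡1 = ≤-antisym m≤1 (≤-trans (≤-reflexive (sym dz≡1)) (≤m z))
  dc≡1 : d c ≡ 1
  dc≡1 = suc-injective (trans 1+dc≡2m (cong (2 *_) m≡1))

module _ {k m} {d : Fin (suc (suc (suc k))) → ℕ} (cond : SharedCondition d (suc m))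
         {z} (dz≡1 : d z ≡ 1) {c′} (heaviest : ∀ v → v ≢ z → d v ≤ d (punchIn z c′)) where

  open SharedCondition cond

  private
    c : Fin (suc (suc (suc k)))
    c = punchIn z c′

    2≤-elsewhere : ∀ v → v ≢ z → 2 ≤ d v
    2≤-elsewhere v v≢z = ≤∧≢⇒< (1≤ v) (λ 1≡dv → v≢z (one-leaf (s≤s (s≤s (s≤s z≤n))) v z (sym 1≡dv) dz≡1))

    2k+3≤m : suc (suc (suc (2 * k))) ≤ suc m
    2k+3≤m = +-cancelʳ-≤ 3 _ _ (subst₂ _≤_ (split k) refl enough)
      where
      split : ∀ k → 2 * suc (suc (suc k)) ≡ suc (suc (suc (2 * k))) + 3
      split = solve-∀

    3≤dc : 3 ≤ d c
    3≤dc with 3 ≤? d c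
    ... | yes 3≤ = 3≤
    ... | no 3≰  = ⊥-elim (<⇒≱ (begin-strict
      1 + suc (suc k) * 2               <⟨ witness⇒≤ (2 * k) (gap k) ⟩
      suc (suc (suc (2 * k))) + suc (suc (suc (2 * k))) ≤⟨ +-mono-≤ 2k+3≤m 2k+3≤m ⟩
      suc m + suc m                     ≡⟨ cong (suc m +_) (+-identityʳ (suc m)) ⟨
      2 * suc m                         ∎) (begin
      2 * suc m                         ≡⟨ sum≡2m ⟨
      ∑ d                               ≤⟨ ∑-≤-at d z (λ v v≢z → ≤-trans (heaviest v v≢z) (≤-pred (≰⇒> 3≰))) ⟩
      d z + suc (suc k) * 2             ≡⟨ cong (_+ suc (suc k) * 2) dz≡1 ⟩
      1 + suc (suc k) * 2               ∎))
      where
      open ≤-Reasoning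
      gap : ∀ k → suc (1 + suc (suc k) * 2) + 2 * k ≡ suc (suc (suc (2 * k))) + suc (suc (suc (2 * k)))
      gap = solve-∀

    ∑-others≡ : ∑ (removeAt d z) ≡ suc (2 * m)
    ∑-others≡ = suc-injective (begin
      1 + ∑ (removeAt d z)       ≡⟨ cong (_+ ∑ (removeAt d z)) dz≡1 ⟨
      d z + ∑ (removeAt d z)     ≡⟨ sum-remove d ⟨
      ∑ d                        ≡⟨ sum≡2m ⟩
      2 * suc m                  ≡⟨ *-suc 2 m ⟩
      suc (suc (2 * m))          ∎)
      where open ≡-Reasoning

    interior≤ : ∀ {i} → i ≢ c′ → d (punchIn z i) ≤ m
    interior≤ {i} i≢c′ with d v ≤? m
      where v = punchIn z i
    ... | yes dv≤m = dv≤m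
    ... | no dv≰m  = ⊥-elim (<-irrefl refl (begin-strict
      suc (2 * m)             <⟨ witness⇒≤ 0 (gap m) ⟩
      suc m + suc m           ≤⟨ +-mono-≤ (≤-trans dv≥ (heaviest v (punchInᵢ≢i z i))) dv≥ ⟩
      d c + d v               ≤⟨ two-terms≤∑ (removeAt d z) (i≢c′ ∘ sym) ⟩
      ∑ (removeAt d z)        ≡⟨ ∑-others≡ ⟩
      suc (2 * m)             ∎))
      where
      open ≤-Reasoning
      v = punchIn z i
      dv≥ : suc m ≤ d v
      dv≥ = ≰⇒> dv≰m
      gap : ∀ m → suc (suc (2 * m)) + 0 ≡ suc m + suc m
      gap = solve-∀

    d′ : Fin (suc (suc k)) → ℕ
    d′ = shrink d z c′ 1

    condition : DisjointCondition d′ m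
    condition = record
      { sum≡2m = +-cancelˡ-≡ 2 _ _ (begin
          2 + ∑ d′                ≡⟨ cong suc (+-comm 1 (∑ d′)) ⟩
          1 + (∑ d′ + 1)          ≡⟨ cong (_+ (∑ d′ + 1)) dz≡1 ⟨
          d z + (∑ d′ + 1)        ≡⟨ ∑-shrink d z c′ 1 (≤-trans (s≤s z≤n) 3≤dc) ⟨
          ∑ d                     ≡⟨ sum≡2m ⟩
          2 * suc m               ≡⟨ *-suc 2 m ⟩
          2 + 2 * m               ∎)
      ; ≤m     = shrink-≤ d z c′ 1 (∸-monoˡ-≤ 1 (≤m c)) interior≤
      ; 2≤     = shrink-≥ d z c′ 1 (∸-monoˡ-≤ 1 3≤dc) (λ {i} _ → 2≤-elsewhere _ (punchInᵢ≢i z i))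
      ; enough = ≤-trans (≤-reflexive (regroup k)) (+-monoˡ-≤ 2 (s≤s⁻¹ 2k+3≤m))
      }
      where
      open ≡-Reasoning
      regroup : ∀ k → 2 * suc (suc k) ≡ suc (suc (2 * k)) + 2
      regroup = solve-∀

  shared-by-leaf : Bispanning 1 d
  shared-by-leaf = attach₁-shrink z c′ 0 z≤n dz≡1 (≤-trans (s≤s z≤n) 3≤dc) (disjoint-bispanning m condition)

module _ {k} {d : Fin (suc (suc k)) → ℕ} (cond : SharedCondition d (suc (2 * k))) (2≤ : ∀ v → 2 ≤ d v)
         {z} (dz≡2 : d z ≡ 2) where

  open SharedCondition cond

  private
    d′ : Fin (suc k) → ℕ
    d′ = shrink d z zero 0

    elsewhere≤ : ∀ i → d (punchIn z i) ≤ 2 * k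
    elsewhere≤ i = +-cancelˡ-≤ (2 + k * 2) _ _ (subst₂ _≤_ (reorder k (d v)) (split k) (begin
      2 + d v + k * 2           ≡⟨ cong (λ x → x + d v + k * 2) dz≡2 ⟨
      d z + d v + k * 2         ≤⟨ ∑-≥-at₂ d (punchInᵢ≢i z i ∘ sym) 2≤ ⟩
      ∑ d                       ≡⟨ sum≡2m ⟩
      2 * suc (2 * k)           ∎))
      where
      open ≤-Reasoning
      v = punchIn z i
      reorder : ∀ k x → 2 + x + k * 2 ≡ 2 + k * 2 + x
      reorder = solve-∀
      split : ∀ k → 2 * suc (2 * k) ≡ 2 + k * 2 + 2 * k
      split = solve-∀

    condition : DisjointCondition d′ (2 * k)
    condition = record
      { sum≡2m = +-cancelˡ-≡ 2 _ _ (begin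
          2 + ∑ d′                ≡⟨ cong (2 +_) (+-identityʳ (∑ d′)) ⟨
          2 + (∑ d′ + 0)          ≡⟨ cong (_+ (∑ d′ + 0)) dz≡2 ⟨
          d z + (∑ d′ + 0)        ≡⟨ ∑-shrink d z zero 0 z≤n ⟨
          ∑ d                     ≡⟨ sum≡2m ⟩
          2 * suc (2 * k)         ≡⟨ *-suc 2 (2 * k) ⟩
          2 + 2 * (2 * k)         ∎)
      ; ≤m     = shrink-≤ d z zero 0 (elsewhere≤ zero) (λ _ → elsewhere≤ _)
      ; 2≤     = shrink-≥ d z zero 0 (2≤ _) (λ _ → 2≤ _)
      ; enough = ≤-reflexive (2[1+n]≡2n+2 k)
      }
      where
      open ≡-Reasoning

  shared-by-degree-two : Bispanning 1 d
  shared-by-degree-two = attach₁-shrink z zero 1 (s≤s z≤n) dz≡2 (≤-trans (s≤s z≤n) (2≤ _)) (disjoint-bispanning (2 * k) condition)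

module _ {j} {d : Fin (suc (suc (suc j))) → ℕ} (cond : SharedCondition d (suc (2 * suc j))) (3≤ : ∀ v → 3 ≤ d v)
         {z} (dz≡3 : d z ≡ 3) where

  open SharedCondition cond

  private
    d′ : Fin (suc (suc j)) → ℕ
    d′ = shrink d z zero 1

    all≤j : ∀ v → d v ≤ j
    all≤j v = +-cancelʳ-≤ (suc (suc j) * 3) _ _ (begin
      d v + suc (suc j) * 3     ≤⟨ ∑-≥-at d v 3≤ ⟩
      ∑ d                       ≡⟨ sum≡2m ⟩
      2 * suc (2 * suc j)       ≡⟨ split j ⟩
      j + suc (suc j) * 3       ∎)
      where
      open ≤-Reasoning
      split : ∀ j → 2 * suc (2 * suc j) ≡ j + suc (suc j) * 3
      split = solve-∀

    condition : SharedCondition d′ (suc (2 * j))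
    condition = record
      { sum≡2m   = +-cancelˡ-≡ 4 _ _ (begin
          4 + ∑ d′                ≡⟨ cong (3 +_) (+-comm 1 (∑ d′)) ⟩
          3 + (∑ d′ + 1)          ≡⟨ cong (_+ (∑ d′ + 1)) dz≡3 ⟨
          d z + (∑ d′ + 1)        ≡⟨ ∑-shrink d z zero 1 (≤-trans (s≤s z≤n) (3≤ _)) ⟨
          ∑ d                     ≡⟨ sum≡2m ⟩
          2 * suc (2 * suc j)     ≡⟨ 2[3+2n]≡4+2[1+2n] j ⟩
          4 + 2 * suc (2 * j)     ∎)
      ; ≤m       = shrink-≤ d z zero 1 (≤-trans (m∸n≤m _ 1) (≤1+2j _)) (λ _ → ≤1+2j _)
      ; 1≤       = λ i → ≤-trans (s≤s z≤n) (2≤d′ i)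
      ; one-leaf = λ _ u _ d′u≡1 _ → ⊥-elim (<⇒≱ (2≤d′ u) (≤-reflexive d′u≡1))
      ; enough   = ≤-reflexive (2[2+n]≡2n+1+3 j)
      }
      where
      open ≡-Reasoning
      ≤1+2j : ∀ v → d v ≤ suc (2 * j)
      ≤1+2j v = ≤-trans (all≤j v) (m≤n⇒m≤1+n (m≤m+n j (j + 0)))
      2≤d′ : ∀ i → 2 ≤ d′ i
      2≤d′ = shrink-≥ d z zero 1 (∸-monoˡ-≤ 1 (3≤ _)) (λ _ → ≤-trans (n≤1+n 2) (3≤ _))

  shared-by-degree-three : (∀ {d′ : Fin (suc (suc j)) → ℕ} → SharedCondition d′ (suc (2 * j)) → Bispanning 1 d′) →
                       Bispanning 1 d
  shared-by-degree-three ih = attach₂-shrink z zero 1 (s≤s z≤n) dz≡3 (≤-trans (n≤1+n 2) (3≤ _)) (ih condition)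

tight-shared : ∀ {k} {d : Fin (suc (suc k)) → ℕ} → SharedCondition d (suc (2 * k)) → (∀ v → 2 ≤ d v) →
               (∀ {m′} → m′ < suc (2 * k) → ∀ {n′} {d′ : Fin n′ → ℕ} → SharedCondition d′ m′ → Bispanning 1 d′) →
               Bispanning 1 d
tight-shared {k} {d} cond 2≤ ih with degree-search d 2 | degree-search d 3
... | inj₁ (z , dz≡2) | _ = shared-by-degree-two cond 2≤ dz≡2
tight-shared {zero}  cond 2≤ ih | inj₂ no-two | inj₁ (z , dz≡3) =
  ⊥-elim (<⇒≱ (s≤s (s≤s z≤n)) (≤-trans (≤-reflexive (sym dz≡3)) (SharedCondition.≤m cond z)))
tight-shared {suc j} cond 2≤ ih | inj₂ no-two | inj₁ (z , dz≡3) =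
  shared-by-degree-three cond (λ v → ≤∧≢⇒< (2≤ v) (no-two v ∘ sym)) dz≡3 (ih (s≤s (*-monoʳ-< 2 (n<1+n j))))
... | inj₂ no-two | inj₂ no-three = ⊥-elim (<⇒≱ (witness⇒≤ 5 (gap k)) (begin
  suc (suc k) * 4     ≤⟨ ∑-≥-const d (heavy-everywhere 2≤ no-two no-three) ⟩
  ∑ d                 ≡⟨ SharedCondition.sum≡2m cond ⟩
  2 * suc (2 * k)     ∎))
  where
  open ≤-Reasoning
  gap : ∀ k → suc (2 * suc (2 * k)) + 5 ≡ suc (suc k) * 4
  gap = solve-∀

shared-bispanning : ∀ m {n} {d : Fin n → ℕ} → SharedCondition d m → Bispanning 1 d
shared-bispanning = <-rec P step
  where
  P : ℕ → Set
  P m = ∀ {n} {d : Fin n → ℕ} → SharedCondition d m → Bispanning 1 d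
  step : ∀ m → (∀ {m′} → m′ < m → P m′) → P m
  step m ih {zero} cond = no-vertices
  step m ih {suc n} {d} cond with degree-search d 1
  step m       ih {suc zero} {d} cond | inj₁ (zero , d₀≡1) =
    ⊥-elim (1+n≢0 (trans (sym d₀≡1) (isolated-vertex {d} sum≡2m (≤m zero))))
    where open SharedCondition cond
  step m       ih {suc (suc zero)} cond | inj₁ (z , dz≡1) = two-leaves cond dz≡1
  step zero    ih {suc (suc (suc k))} cond | inj₁ (z , dz≡1) =
    ⊥-elim (<⇒≱ ≤-refl (≤-trans (≤-reflexive (sym dz≡1)) (SharedCondition.≤m cond z)))
  step (suc m) ih {suc (suc (suc k))} {d} cond | inj₁ (z , dz≡1) = shared-by-leaf cond dz≡1 (proj₂ (heaviest-except d z))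
  step m ih {suc n} {d} cond | inj₂ no-leaf with 2 * suc n ≤? m + 2
  ... | yes slack = weaken z≤n (disjoint-bispanning m (record
    { sum≡2m = sum≡2m ; ≤m = ≤m ; 2≤ = 2≤ ; enough = slack }))
    where
    open SharedCondition cond
    2≤ : ∀ v → 2 ≤ d v
    2≤ v = ≤∧≢⇒< (1≤ v) (no-leaf v ∘ sym)
  step m ih {suc zero} cond | inj₂ no-leaf | no tight = ⊥-elim (tight (m≤n+m 2 m))
  step m ih {suc (suc k)} {d} cond | inj₂ no-leaf | no tight =
    tight-shared (subst (SharedCondition d) m≡1+2k cond) 2≤ (λ m′< → ih (subst (_ <_) (sym m≡1+2k) m′<))
    where
    open SharedCondition cond
    2≤ : ∀ v → 2 ≤ d v
    2≤ v = ≤∧≢⇒< (1≤ v) (no-leaf v ∘ sym)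
    m≡1+2k : m ≡ suc (2 * k)
    m≡1+2k = +-cancelʳ-≡ 3 _ _ (begin
      m + 3                  ≡⟨ +-suc m 2 ⟩
      suc (m + 2)            ≡⟨ ≰∧≤suc⇒≡suc tight (≤-trans enough (≤-reflexive (+-suc m 2))) ⟨
      2 * suc (suc k)        ≡⟨ 2[2+n]≡2n+1+3 k ⟩
      suc (2 * k) + 3        ∎)
      where
      open ≡-Reasoning

bispanning⇒two-trees : ∀ {n} {d : Fin n → ℕ} → Bispanning 1 d → TwoTreeRealization n d
bispanning⇒two-trees B with spanningTreeWithin graph connected₁ | spanningTreeWithin graph connected₂
  where open Bispanning B
... | T₁ , T₁⊆S₁ , tree₁ | T₂ , T₂⊆S₂ , tree₂ =
  graph , realizes , T₁ , T₂ , tree₁ , tree₂ , ≤-trans (p⊆q⇒∣p∣≤∣q∣ T₁∩T₂⊆S₁∩S₂) shared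
  where
  open Bispanning B
  T₁∩T₂⊆S₁∩S₂ : T₁ ∩ T₂ ⊆ S₁ ∩ S₂
  T₁∩T₂⊆S₁∩S₂ e∈ with x∈p∩q⁻ T₁ T₂ e∈
  ... | e∈T₁ , e∈T₂ = x∈p∩q⁺ (T₁⊆S₁ e∈T₁ , T₂⊆S₂ e∈T₂)

module _ {n} {d : Fin (suc (suc n)) → ℕ} (noninc : NonIncreasing d) (ends : EndDegrees (suc (suc n)) d) where

  private
    second-last = proj₁ ends
    last        = proj₂ ends

  end-degrees⇒1≤ : ∀ v → 1 ≤ d v
  end-degrees⇒1≤ v = ≤-trans (last (fromℕ (suc n)) (trans (cong (_+ 1) (toℕ-fromℕ (suc n))) (+-comm (suc n) 1)))
                            (noninc v (fromℕ (suc n)) (≤-trans (≤-pred (toℕ<n v)) (≤-reflexive (sym (toℕ-fromℕ (suc n))))))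

  end-degrees⇒leaf-last : ∀ v → d v ≡ 1 → toℕ v ≡ suc n
  end-degrees⇒leaf-last v dv≡1 with toℕ v ≤? n
  ... | no v≰n  = ≤-antisym (≤-pred (toℕ<n v)) (≰⇒> v≰n)
  ... | yes v≤n = ⊥-elim (<⇒≱ (second-last x (trans (cong (_+ 2) toℕx≡n) (+-comm n 2)))
                                (≤-trans (noninc v x (≤-trans v≤n (≤-reflexive (sym toℕx≡n)))) (≤-reflexive dv≡1)))
    where
    x : Fin (suc (suc n))
    x = inject₁ (fromℕ n)
    toℕx≡n : toℕ x ≡ n
    toℕx≡n = trans (toℕ-inject₁ (fromℕ n)) (toℕ-fromℕ n)

two-vertex-degrees : ∀ {d : Fin 2 → ℕ} {m} → ∑ d ≡ 2 * m → (∀ v → d v ≤ m) → ∀ v → m ≤ d v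
two-vertex-degrees {d} {m} sum≡2m ≤m v = +-cancelʳ-≤ m _ _ (begin
  m + m            ≡⟨ cong (m +_) (+-identityʳ m) ⟨
  2 * m            ≡⟨ sum≡2m ⟨
  ∑ d              ≤⟨ ∑-≤-at d v (λ w _ → ≤m w) ⟩
  d v + 1 * m      ≡⟨ cong (d v +_) (*-identityˡ m) ⟩
  d v + m          ∎)
  where open ≤-Reasoning

sufficiency : ∀ {n} {d : Fin n → ℕ} → NonIncreasing d → Multigraphical d → DegreeCondition n d → TwoTreeRealization n d
sufficiency {zero}          _      _          _                     = bispanning⇒two-trees no-vertices
sufficiency {suc zero}      {d} _  (G , real) _                     =
  bispanning⇒two-trees (single-vertex (isolated-vertex {d} (realization-∑ G real) (realization-≤ G real zero)))
sufficiency {suc (suc n)} {d} noninc (G , real) (sum-bound , shape) = bispanning⇒two-trees (shared-bispanning (m G) (record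
  { sum≡2m   = realization-∑ G real
  ; ≤m       = realization-≤ G real
  ; 1≤       = positive shape
  ; one-leaf = one-leaf shape
  ; enough   = *-cancelˡ-≤ 2 (begin
      2 * (2 * suc (suc n))  ≡⟨ *-assoc 2 2 (suc (suc n)) ⟨
      4 * suc (suc n)        ≤⟨ sum-bound ⟩
      Σd d + 6               ≡⟨ cong (_+ 6) (trans (sum-allFin d) (realization-∑ G real)) ⟩
      2 * m G + 6            ≡⟨ 2m+6≡2[m+3] (m G) ⟩
      2 * (m G + 3)          ∎)
  }))
  where
  open ≤-Reasoning
  2m+6≡2[m+3] : ∀ m → 2 * m + 6 ≡ 2 * (m + 3)
  2m+6≡2[m+3] = solve-∀
  positive : (suc (suc n) ≤ 2) ⊎ ((suc (suc n) > 2) × EndDegrees (suc (suc n)) d) → ∀ v → 1 ≤ d v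
  positive (inj₁ (s≤s (s≤s z≤n))) v = ≤-trans 1≤m (two-vertex-degrees (realization-∑ G real) (realization-≤ G real) v)
    where
    1≤m : 1 ≤ m G
    1≤m = *-cancelˡ-≤ 2 (+-cancelʳ-≤ 6 2 (2 * m G)
            (≤-trans sum-bound (≤-reflexive (cong (_+ 6) (trans (sum-allFin d) (realization-∑ G real))))))
  positive (inj₂ (_ , ends)) = end-degrees⇒1≤ noninc ends
  one-leaf : (suc (suc n) ≤ 2) ⊎ ((suc (suc n) > 2) × EndDegrees (suc (suc n)) d) →
             2 < suc (suc n) → ∀ u v → d u ≡ 1 → d v ≡ 1 → u ≡ v
  one-leaf (inj₁ N≤2) 2<N = ⊥-elim (<⇒≱ 2<N N≤2)
  one-leaf (inj₂ (_ , ends)) _ u v du≡1 dv≡1 =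
    toℕ-injective (trans (end-degrees⇒leaf-last noninc ends u du≡1) (sym (end-degrees⇒leaf-last noninc ends v dv≡1)))

theorem5p3 : (n : ℕ) (d : Fin n → ℕ) → NonIncreasing d → Multigraphical d →
    (Σ (Multigraph n) (λ G → Realizes G d × TwoTreesShareAtMostOne G))
    ⇔ ((4 * n ≤ Σd d + 6) ×
       ((n ≤ 2) ⊎
        ((n > 2) ×
         (∀ (i : Fin n) → toℕ i + 2 ≡ n → 2 ≤ d i) ×
         (∀ (i : Fin n) → toℕ i + 1 ≡ n → 1 ≤ d i))))
theorem5p3 n d noninc multigraphical = mk⇔ (necessity noninc) (sufficiency noninc multigraphical)
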